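{- Let $\Gamma$ be a weighted digraph with Laplacian matrix $L$, in-forest dimension $d$, and in-forest matrices $Q_k$ as in the context. Then for every $\lambda\in\mathbb C$ (with the convention $\lambda^0=1$), $$\operatorname{adj}(\lambda I+L)=\sum_{k=0}^{n-d}Q_k\lambda^{n-k-1},$$ where $\operatorname{adj}$ denotes the adjugate (transposed cofactor) matrix.
   Context: $\Gamma$ is a weighted digraph without loops on vertex set $\{1,\dots,n\}$, $n>1$, with strictly positive arc weights $w_{ij}$ ($w_{ij}=0$ if there is no arc $i\to j$). Its Laplacian $L=(\ell_{ij})$ has $\ell_{ij}=-w_{ij}$ for $j\ne i$, $\ell_{ii}=\sum_{k\ne i}w_{ik}$. The weight of a subgraph is the product of its arc weights (1 if no arcs); the weight of a set of subgraphs is the sum of their weights (0 if empty). A converging tree is a weakly connected digraph in which one vertex (the root) has outdegree 0 and all others outdegree 1; an in-forest of $\Gamma$ is a spanning subgraph all of whose weak components are converging trees. $d$ is the minimum number of trees in an in-forest of $\Gamma$. For $k\ge0$, $Q_k=(q^k_{ij})$ where $q^k_{ij}$ is the total weight of in-forests of $\Gamma$ with $k$ arcs in which $i$ belongs to the tree rooted at $j$ (so $Q_0=I$, $Q_k=0$ for $k>n-d$). -}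

module Defs where

open import Level using (_⊔_)
open import Algebra.Bundles using (CommutativeRing)
open import Data.Nat as ℕ using (ℕ; zero; suc; _∸_; _≡ᵇ_; _⊓_)
open import Data.Fin using (Fin; zero; suc; punchIn; toℕ; _≟_)
open import Data.Maybe using (Maybe; nothing; just; maybe)
open import Data.Bool using (Bool; true; false; if_then_else_; _∧_)
open import Data.List using (List; []; _∷_; map; concatMap; foldr; allFin)
open import Data.Vec using (Vec; []; _∷_; lookup)
open import Relation.Nullary using (does)
open import Relation.Binary.PropositionalEquality using (_≡_)

allVecs : ∀ {a} {A : Set a} → List A → (k : ℕ) → List (Vec A k)
allVecs xs zero    = [] ∷ []
allVecs xs (suc k) = concatMap (λ x → map (x ∷_) (allVecs xs k)) xs

filterB : ∀ {a} {A : Set a} → (A → Bool) → List A → List A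
filterB p []       = []
filterB p (x ∷ xs) = if p x then x ∷ filterB p xs else filterB p xs

allB : (n : ℕ) → (Fin n → Bool) → Bool
allB zero    p = true
allB (suc n) p = p zero ∧ allB n (λ i → p (suc i))

countB : (n : ℕ) → (Fin n → Bool) → ℕ
countB zero    p = 0
countB (suc n) p = (if p zero then 1 else 0) ℕ.+ countB n (λ i → p (suc i))

-- A spanning subgraph with all outdegrees ≤ 1 of a digraph on {1..n}
-- is encoded by, for every vertex i, its unique out-neighbour
-- (just j: the arc i → j is in the subgraph) or nothing (outdegree 0).
OutSub : ℕ → Set
OutSub n = Vec (Maybe (Fin n)) n

allOutSubs : (n : ℕ) → List (OutSub n)
allOutSubs n = allVecs (nothing ∷ map just (allFin n)) n

walk : ∀ {n} → OutSub n → ℕ → Fin n → Fin n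
walk f zero    i = i
walk f (suc t) i with lookup f i
... | nothing = i
... | just j  = walk f t j

isNothing : ∀ {a} {A : Set a} → Maybe A → Bool
isNothing nothing  = true
isNothing (just _) = false

arcCount : ∀ {n} → OutSub n → ℕ
arcCount {n} f = countB n (λ i → if isNothing (lookup f i) then false else true)

rootCount : ∀ {n} → OutSub n → ℕ
rootCount {n} f = countB n (λ i → isNothing (lookup f i))

rootOf : ∀ {n} → OutSub n → Fin n → Fin n
rootOf {n} f i = walk f n i

-- no directed cycles: every walk reaches a vertex of outdegree 0
-- (then every weak component is a converging tree)
acyclicB : ∀ {n} → OutSub n → Bool
acyclicB {n} f = allB n (λ i → isNothing (lookup f (rootOf f i)))

record WDigraph {c ℓ} (R : CommutativeRing c ℓ) (n : ℕ) : Set c where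
  open CommutativeRing R using (Carrier)
  field
    arc     : Fin n → Fin n → Bool
    noLoops : ∀ i → arc i i ≡ false
    weight  : Fin n → Fin n → Carrier

module _ {c ℓ} (R : CommutativeRing c ℓ) where
  open CommutativeRing R using (Carrier; _+_; _*_; -_; 0#; 1#)

  sumFin : (n : ℕ) → (Fin n → Carrier) → Carrier
  sumFin zero    v = 0#
  sumFin (suc n) v = v zero + sumFin n (λ i → v (suc i))

  prodFin : (n : ℕ) → (Fin n → Carrier) → Carrier
  prodFin zero    v = 1#
  prodFin (suc n) v = v zero * prodFin n (λ i → v (suc i))

  sumList : List Carrier → Carrier
  sumList = foldr _+_ 0#

  sumUpTo : ℕ → (ℕ → Carrier) → Carrier
  sumUpTo zero    a = a zero
  sumUpTo (suc N) a = sumUpTo N a + a (suc N)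

  pow : Carrier → ℕ → Carrier
  pow x zero    = 1#
  pow x (suc k) = x * pow x k

  sgn : ℕ → Carrier
  sgn zero    = 1#
  sgn (suc k) = - sgn k

  Matrix : ℕ → Set c
  Matrix n = Fin n → Fin n → Carrier

  idMat : ∀ {n} → Matrix n
  idMat i j = if does (i ≟ j) then 1# else 0#

  det : (n : ℕ) → Matrix n → Carrier
  det zero    M = 1#
  det (suc n) M = sumFin (suc n) (λ j → sgn (toℕ j) * (M zero j * det n (λ a b → M (suc a) (punchIn j b))))

  adj : (n : ℕ) → Matrix n → Matrix n
  adj zero    M ()
  adj (suc n) M i j = sgn (toℕ i ℕ.+ toℕ j) * det n (λ a b → M (punchIn j a) (punchIn i b))

  module _ {n : ℕ} (G : WDigraph R n) where
    open WDigraph G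

    w : Fin n → Fin n → Carrier
    w i j = if arc i j then weight i j else 0#

    laplacian : Matrix n
    laplacian i j = if does (i ≟ j)
                      then sumFin n (λ k → if does (k ≟ i) then 0# else w i k)
                      else - w i j

    isSubB : OutSub n → Bool
    isSubB f = allB n (λ i → maybe (λ j → arc i j) true (lookup f i))

    inForests : List (OutSub n)
    inForests = filterB (λ f → isSubB f ∧ acyclicB f) (allOutSubs n)

    forestWeight : OutSub n → Carrier
    forestWeight f = prodFin n (λ i → maybe (λ j → w i j) 1# (lookup f i))

    -- in-forest dimension: minimum number of trees in an in-forest
    -- (the empty-arc forest has n trees, so n is a valid start value)
    forestDim : ℕ
    forestDim = foldr (λ f m → rootCount f ⊓ m) n inForests

    Q : ℕ → Matrix n
    Q k i j = sumList (map forestWeight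
                (filterB (λ f → (arcCount f ≡ᵇ k) ∧ does (rootOf f i ≟ j)) inForests))

    shiftedLaplacian : Carrier → Matrix n
    shiftedLaplacian x i j = x * idMat i j + laplacian i j

{-# OPTIONS --safe #-}
-- Every square matrix M over a commutative ring has a forest expansion: det M
-- is the sum, over the acyclic functional digraphs f on its index set, of the
-- product over all vertices a of the a-th row sum of M if a is a root of f, and
-- of -M a b if f has the arc a → b.  This goes by induction on the size: for each
-- possible out-neighbour t of vertex 0, adding column 0 to column t and deleting
-- row and column 0 contracts vertex 0 into t, and the Laplace expansion along
-- row 0 regroups into these contracted determinants.
-- Replacing row j of M by the unit row eᵢ computes adj(M) i j.  In the forest
-- expansion of that matrix the forests with the arc j → i cancel the forests with
-- root j, except those in which adding j → i closes a cycle, i.e. in which i lies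
-- in the tree rooted at j.  For M = λI + L the row sums are λ and -M a b = w a b,
-- so such a forest with k arcs contributes its weight times λ^(n-k-1), one factor
-- λ for each root other than j.

module Submission where

open import Defs
open import Algebra.Bundles using (CommutativeRing)
open import Data.Nat using (ℕ; _≤_; _∸_)
open import Data.Fin using (Fin)

open import Data.Nat as ℕ using (zero; suc)
import Data.Nat.Properties as ℕ
open import Data.Fin using (zero; suc; punchIn; punchOut; toℕ; _≟_; inject₁)
import Data.Fin.Properties as Fin
open import Data.Maybe as Maybe using (Maybe; nothing; just; maybe)
open import Data.Bool using (Bool; true; false; if_then_else_; _∧_; not)
open import Data.Bool.Properties using (⇔→≡; ∧-zeroʳ; ∧-identityʳ)
open import Data.List as List using (List; []; _∷_)
open import Data.Vec as Vec using (Vec; _∷_; lookup)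
import Data.Vec.Properties as Vec
import Data.List.Properties as List
open import Data.List.Membership.Propositional using (_∈_)
open import Data.List.Relation.Unary.Any using (here; there)
open import Data.Maybe.Properties using (≡-dec)
open import Data.Product using (_×_; _,_; proj₂; ∃-syntax)
open import Data.Sum using (_⊎_; inj₁; inj₂)
open import Data.Empty using (⊥; ⊥-elim)
open import Function using (_∘_; _⇔_; mk⇔; Equivalence)
open import Function.Properties.Equivalence using () renaming (sym to ⇔-sym)
open import Function.Construct.Composition using (_⇔-∘_)
open import Relation.Nullary using (does; yes; no)
open import Relation.Nullary.Decidable using (dec-true; dec-false)
import Relation.Binary.PropositionalEquality as ≡
open import Relation.Binary.PropositionalEquality using (_≡_; _≢_)
open import Relation.Binary.Definitions using (DecidableEquality)

swapAdjacent : ∀ {m} → Fin m → Fin (suc m) → Fin (suc m)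
swapAdjacent zero    zero          = suc zero
swapAdjacent zero    (suc zero)    = zero
swapAdjacent zero    (suc (suc x)) = suc (suc x)
swapAdjacent (suc c) zero          = zero
swapAdjacent (suc c) (suc x)       = suc (swapAdjacent c x)

Adjacent : ℕ → ℕ → Set
Adjacent a b = a ≡ suc b ⊎ suc a ≡ b

Adjacent-suc : ∀ {a b} → Adjacent a b → Adjacent (suc a) (suc b)
Adjacent-suc (inj₁ e) = inj₁ (≡.cong suc e)
Adjacent-suc (inj₂ e) = inj₂ (≡.cong suc e)

swapAdjacent-punchIn : ∀ {m} (c : Fin (suc m)) (l : Fin (suc (suc m))) →
  (Adjacent (toℕ (swapAdjacent c l)) (toℕ l) ×
     (∀ b → swapAdjacent c (punchIn l b) ≡ punchIn (swapAdjacent c l) b))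
  ⊎ (∃[ c′ ] swapAdjacent c l ≡ l ×
       (∀ b → swapAdjacent c (punchIn l b) ≡ punchIn l (swapAdjacent c′ b)))
swapAdjacent-punchIn zero zero = inj₁ (inj₁ ≡.refl , λ { zero → ≡.refl ; (suc b) → ≡.refl })
swapAdjacent-punchIn zero (suc zero) = inj₁ (inj₂ ≡.refl , λ { zero → ≡.refl ; (suc b) → ≡.refl })
swapAdjacent-punchIn {suc m} zero (suc (suc l)) =
  inj₂ (zero , ≡.refl , λ { zero → ≡.refl ; (suc zero) → ≡.refl ; (suc (suc b)) → ≡.refl })
swapAdjacent-punchIn (suc c) zero = inj₂ (c , ≡.refl , λ b → ≡.refl)
swapAdjacent-punchIn {suc m} (suc c) (suc l) with swapAdjacent-punchIn c l
... | inj₁ (adj , eq) = inj₁ (Adjacent-suc adj , λ { zero → ≡.refl ; (suc b) → ≡.cong suc (eq b) })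
... | inj₂ (c′ , e , eq) = inj₂ (suc c′ , ≡.cong suc e , λ { zero → ≡.refl ; (suc b) → ≡.cong suc (eq b) })

zeroAt : ∀ {n} → Fin n → Fin n → Fin (suc n)
zeroAt zero    zero    = zero
zeroAt zero    (suc b) = suc (suc b)
zeroAt (suc k) zero    = suc zero
zeroAt (suc k) (suc b) = punchIn (suc zero) (zeroAt k b)

zeroAt-same : ∀ {n} (k : Fin n) → zeroAt k k ≡ zero
zeroAt-same zero    = ≡.refl
zeroAt-same (suc k) = ≡.cong (punchIn (suc zero)) (zeroAt-same k)

zeroAt-other : ∀ {n} (k b : Fin n) → b ≢ k → zeroAt k b ≡ suc b
zeroAt-other zero    zero    b≢k = ⊥-elim (b≢k ≡.refl)
zeroAt-other zero    (suc b) b≢k = ≡.refl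
zeroAt-other (suc k) zero    b≢k = ≡.refl
zeroAt-other (suc k) (suc b) b≢k = ≡.cong (punchIn (suc zero)) (zeroAt-other k b (b≢k ∘ ≡.cong suc))

zeroAt-zero : ∀ {n} (b : Fin (suc n)) → zeroAt zero b ≡ punchIn (suc zero) b
zeroAt-zero zero    = ≡.refl
zeroAt-zero (suc b) = ≡.refl

zeroAt-suc : ∀ {n} (k : Fin n) (b : Fin (suc n)) →
             zeroAt (suc k) b ≡ swapAdjacent (suc k) (zeroAt (inject₁ k) (swapAdjacent k b))
zeroAt-suc zero    zero          = ≡.refl
zeroAt-suc zero    (suc zero)    = ≡.refl
zeroAt-suc zero    (suc (suc b)) = ≡.refl
zeroAt-suc (suc k) zero          = ≡.refl
zeroAt-suc (suc k) (suc b)       = ≡.trans (≡.cong (punchIn (suc zero)) (zeroAt-suc k b)) (punch₁-swap k _)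
  where
  punch₁-swap : ∀ {n} (k : Fin n) (y : Fin (suc (suc n))) →
                punchIn (suc zero) (swapAdjacent (suc k) y) ≡ swapAdjacent (suc (suc k)) (punchIn (suc zero) y)
  punch₁-swap k zero    = ≡.refl
  punch₁-swap k (suc y) = ≡.refl

swapAdjacent-punchIn-suc : ∀ {n} (k : Fin n) (b : Fin (suc n)) →
                           swapAdjacent (suc k) (punchIn (suc (inject₁ k)) b) ≡ punchIn (suc (suc k)) b
swapAdjacent-punchIn-suc zero    zero          = ≡.refl
swapAdjacent-punchIn-suc zero    (suc zero)    = ≡.refl
swapAdjacent-punchIn-suc zero    (suc (suc b)) = ≡.refl
swapAdjacent-punchIn-suc (suc k) zero          = ≡.refl
swapAdjacent-punchIn-suc (suc k) (suc b)       = ≡.cong suc (swapAdjacent-punchIn-suc k b)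

-- A total punchOut: the position of c once j is deleted (junk value zero for c = j).
punchOutAt : ∀ {k} → Fin (suc (suc k)) → Fin (suc (suc k)) → Fin (suc k)
punchOutAt zero    zero    = zero
punchOutAt zero    (suc c) = c
punchOutAt (suc j) zero    = zero
punchOutAt {suc k} (suc j) (suc c) = suc (punchOutAt j c)
punchOutAt {zero}  (suc j) (suc c) = zero

punchOutAt-punchIn : ∀ {k} (j : Fin (suc (suc k))) (l : Fin (suc k)) → punchOutAt j (punchIn j l) ≡ l
punchOutAt-punchIn zero    l       = ≡.refl
punchOutAt-punchIn (suc j) zero    = ≡.refl
punchOutAt-punchIn {suc k} (suc j) (suc l) = ≡.cong suc (punchOutAt-punchIn j l)

punchIn-punchIn-punchOutAt : ∀ {k} (c : Fin (suc (suc k))) (l : Fin (suc k)) (b : Fin k) →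
  punchIn (punchIn c l) (punchIn (punchOutAt (punchIn c l) c) b) ≡ punchIn c (punchIn l b)
punchIn-punchIn-punchOutAt zero    l       b       = ≡.refl
punchIn-punchIn-punchOutAt (suc c) zero    b       = ≡.refl
punchIn-punchIn-punchOutAt {suc k} (suc c) (suc l) zero    = ≡.refl
punchIn-punchIn-punchOutAt {suc k} (suc c) (suc l) (suc b) = ≡.cong suc (punchIn-punchIn-punchOutAt c l b)

data ReachesRoot {n} (f : OutSub n) : Fin n → Fin n → Set where
  stop : ∀ {a} → lookup f a ≡ nothing → ReachesRoot f a a
  step : ∀ {a b r} → lookup f a ≡ just b → ReachesRoot f b r → ReachesRoot f a r

Acyclic : ∀ {n} → OutSub n → Set
Acyclic {n} f = ∀ a → ∃[ r ] ReachesRoot f a r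

module _ {n} {f : OutSub n} where

  reachesRoot-isRoot : ∀ {a r} → ReachesRoot f a r → lookup f r ≡ nothing
  reachesRoot-isRoot (stop e)   = e
  reachesRoot-isRoot (step e d) = reachesRoot-isRoot d

  reachesRoot-fromRoot : ∀ {a r} → lookup f a ≡ nothing → ReachesRoot f a r → r ≡ a
  reachesRoot-fromRoot e (stop _)    = ≡.refl
  reachesRoot-fromRoot e (step e′ d) with ≡.trans (≡.sym e) e′
  ... | ()

  reachesRoot-next : ∀ {a b r} → lookup f a ≡ just b → ReachesRoot f a r → ReachesRoot f b r
  reachesRoot-next e (stop e′) with ≡.trans (≡.sym e) e′
  ... | ()
  reachesRoot-next e (step e′ d) with ≡.trans (≡.sym e) e′
  ... | ≡.refl = d

  selfLoop-¬reachesRoot : ∀ {a r} → lookup f a ≡ just a → ReachesRoot f a r → ⊥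
  selfLoop-¬reachesRoot e (stop e′) with ≡.trans (≡.sym e) e′
  ... | ()
  selfLoop-¬reachesRoot e (step e′ d) with ≡.trans (≡.sym e) e′
  ... | ≡.refl = selfLoop-¬reachesRoot e d

  walk-fromRoot : ∀ {a} → lookup f a ≡ nothing → ∀ t → walk f t a ≡ a
  walk-fromRoot e zero    = ≡.refl
  walk-fromRoot e (suc t) rewrite e = ≡.refl

  walk-+ : ∀ p q a → walk f (p ℕ.+ q) a ≡ walk f q (walk f p a)
  walk-+ zero    q a = ≡.refl
  walk-+ (suc p) q a with lookup f a in e
  ... | nothing = ≡.sym (walk-fromRoot e q)
  ... | just b  = walk-+ p q b

  walk-step : ∀ {a b} → lookup f a ≡ just b → ∀ t → walk f (suc t) a ≡ walk f t b
  walk-step e t rewrite e = ≡.refl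

  reachesRoot⇒walk : ∀ {a r} → ReachesRoot f a r → ∃[ t ] walk f t a ≡ r
  reachesRoot⇒walk (stop e)   = zero , ≡.refl
  reachesRoot⇒walk (step e d) with reachesRoot⇒walk d
  ... | t , w = suc t , ≡.trans (walk-step e t) w

  walk⇒reachesRoot : ∀ t a → lookup f (walk f t a) ≡ nothing → ReachesRoot f a (walk f t a)
  walk⇒reachesRoot zero    a e = stop e
  walk⇒reachesRoot (suc t) a e with lookup f a in e′
  ... | nothing = stop e′
  ... | just b  = step e′ (walk⇒reachesRoot t b e)

  -- Pigeonhole: among the first n + 1 vertices of a longer walk two coincide,
  -- and cutting out the cycle between them shortens the walk.
  walk-settles : ∀ a t → lookup f (walk f t a) ≡ nothing → walk f n a ≡ walk f t a
  walk-settles a t = byFuel (suc t) t (ℕ.n<1+n t)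
    where
    byFuel : ∀ fuel t → t ℕ.< fuel → lookup f (walk f t a) ≡ nothing → walk f n a ≡ walk f t a
    byFuel (suc fuel) t t<fuel e with t ℕ.≤? n
    ... | yes t≤n = begin
      walk f n a                   ≡⟨ ≡.cong (λ s → walk f s a) (ℕ.m+[n∸m]≡n t≤n) ⟨
      walk f (t ℕ.+ (n ∸ t)) a     ≡⟨ walk-+ t (n ∸ t) a ⟩
      walk f (n ∸ t) (walk f t a)  ≡⟨ walk-fromRoot e (n ∸ t) ⟩
      walk f t a                   ∎
      where open ≡.≡-Reasoning
    ... | no t≰n with Fin.pigeonhole (ℕ.n<1+n n) (λ u → walk f (toℕ u) a)
    ...   | p , q , p<q , walk-p≡walk-q =
      ≡.trans (byFuel fuel t′ (ℕ.<-≤-trans t′<t (ℕ.≤-pred t<fuel))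
                      (≡.subst (λ v → lookup f v ≡ nothing) walk-t≡walk-t′ e))
              (≡.sym walk-t≡walk-t′)
      where
      q≤t : toℕ q ℕ.≤ t
      q≤t = ℕ.≤-trans (ℕ.≤-pred (Fin.toℕ<n q)) (ℕ.<⇒≤ (ℕ.≰⇒> t≰n))
      t′ = toℕ p ℕ.+ (t ∸ toℕ q)
      walk-t≡walk-t′ : walk f t a ≡ walk f t′ a
      walk-t≡walk-t′ = begin
        walk f t a                                ≡⟨ ≡.cong (λ s → walk f s a) (ℕ.m+[n∸m]≡n q≤t) ⟨
        walk f (toℕ q ℕ.+ (t ∸ toℕ q)) a          ≡⟨ walk-+ (toℕ q) (t ∸ toℕ q) a ⟩
        walk f (t ∸ toℕ q) (walk f (toℕ q) a)     ≡⟨ ≡.cong (walk f (t ∸ toℕ q)) walk-p≡walk-q ⟨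
        walk f (t ∸ toℕ q) (walk f (toℕ p) a)     ≡⟨ walk-+ (toℕ p) (t ∸ toℕ q) a ⟨
        walk f t′ a                               ∎
        where open ≡.≡-Reasoning
      t′<t : t′ ℕ.< t
      t′<t = ≡.subst (t′ ℕ.<_) (ℕ.m+[n∸m]≡n q≤t) (ℕ.+-monoˡ-< (t ∸ toℕ q) p<q)

  reachesRoot⇒rootOf : ∀ {a r} → ReachesRoot f a r → rootOf f a ≡ r
  reachesRoot⇒rootOf {a} d with reachesRoot⇒walk d
  ... | t , ≡.refl = walk-settles a t (reachesRoot-isRoot d)

allB≡true⇒∀ : ∀ n (p : Fin n → Bool) → allB n p ≡ true → ∀ i → p i ≡ true
allB≡true⇒∀ (suc n) p e i with p zero in p₀
allB≡true⇒∀ (suc n) p e zero    | true = p₀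
allB≡true⇒∀ (suc n) p e (suc i) | true = allB≡true⇒∀ n (p ∘ suc) e i

∀⇒allB≡true : ∀ n (p : Fin n → Bool) → (∀ i → p i ≡ true) → allB n p ≡ true
∀⇒allB≡true zero    p h = ≡.refl
∀⇒allB≡true (suc n) p h rewrite h zero = ∀⇒allB≡true n (p ∘ suc) (h ∘ suc)

isNothing⇒≡nothing : ∀ {A : Set} {x : Maybe A} → isNothing x ≡ true → x ≡ nothing
isNothing⇒≡nothing {x = nothing} _ = ≡.refl

acyclicB⇔Acyclic : ∀ {n} (f : OutSub n) → acyclicB f ≡ true ⇔ Acyclic f
acyclicB⇔Acyclic {n} f = mk⇔
  (λ e a → rootOf f a , walk⇒reachesRoot n a (isNothing⇒≡nothing (allB≡true⇒∀ n _ e a)))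
  (λ acyc → ∀⇒allB≡true n _ (λ a → rootIsRoot (acyc a)))
  where
  rootIsRoot : ∀ {a} → ∃[ r ] ReachesRoot f a r → isNothing (lookup f (rootOf f a)) ≡ true
  rootIsRoot (r , d) rewrite reachesRoot⇒rootOf d | reachesRoot-isRoot d = ≡.refl

acyclicB-≡ : ∀ {m n} (f : OutSub m) (g : OutSub n) → Acyclic f ⇔ Acyclic g → acyclicB f ≡ acyclicB g
acyclicB-≡ f g f⇔g = ⇔→≡ (⇔-sym (acyclicB⇔Acyclic g) ⇔-∘ (f⇔g ⇔-∘ acyclicB⇔Acyclic f))

acyclicB⇒reachesRoot : ∀ {n} (f : OutSub n) → acyclicB f ≡ true → ∀ a → ReachesRoot f a (rootOf f a)
acyclicB⇒reachesRoot f e a with Equivalence.to (acyclicB⇔Acyclic f) e a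
... | r , d rewrite reachesRoot⇒rootOf d = d

rootOf-isRoot : ∀ {n} (f : OutSub n) (i : Fin n) → acyclicB f ≡ true → lookup f (rootOf f i) ≡ nothing
rootOf-isRoot f i e = reachesRoot-isRoot (acyclicB⇒reachesRoot f e i)

acyclicB-noSelfLoop : ∀ {n} (f : OutSub n) {a b : Fin n} → acyclicB f ≡ true → lookup f a ≡ just b → a ≢ b
acyclicB-noSelfLoop f {a} e l ≡.refl = selfLoop-¬reachesRoot l (acyclicB⇒reachesRoot f e a)

acyclicB-selfLoop₀ : ∀ {n} (rest : Vec (Maybe (Fin (suc n))) n) → acyclicB {suc n} (just zero ∷ rest) ≡ false
acyclicB-selfLoop₀ rest with acyclicB (just zero ∷ rest) in e
... | false = ≡.refl
... | true  = ⊥-elim (acyclicB-noSelfLoop (just zero ∷ rest) {zero} e ≡.refl ≡.refl)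

-- Contracting vertex 0 into its out-neighbour
redirect : ∀ {n} → Maybe (Fin n) → Maybe (Fin (suc n)) → Maybe (Fin n)
redirect t nothing        = nothing
redirect t (just zero)    = t
redirect t (just (suc b)) = just b

contract : ∀ {n} → Maybe (Fin n) → Vec (Maybe (Fin (suc n))) n → OutSub n
contract t rest = Vec.map (redirect t) rest

module _ {n} (rest : Vec (Maybe (Fin (suc n))) n) where

  private
    lookup-contract : ∀ t {b x} → lookup rest b ≡ x → lookup (contract t rest) b ≡ redirect t x
    lookup-contract t {b} e = ≡.trans (Vec.lookup-map b (redirect t) rest) (≡.cong (redirect t) e)

  contract-reachesRoot : ∀ t {b r} → ReachesRoot (Maybe.map suc t ∷ rest) (suc b) r →
                         ∃[ r′ ] ReachesRoot (contract t rest) b r′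
  contract-reachesRoot t (stop e) = _ , stop (lookup-contract t e)
  contract-reachesRoot t (step {b = suc c} e d) with contract-reachesRoot t d
  ... | r′ , d′ = r′ , step (lookup-contract t e) d′
  contract-reachesRoot nothing  (step {b = zero} e d) = _ , stop (lookup-contract nothing e)
  contract-reachesRoot (just k) (step {b = zero} e (step ≡.refl d)) with contract-reachesRoot (just k) d
  ... | r′ , d′ = r′ , step (lookup-contract (just k) e) d′

  reachesRoot-uncontract : ∀ t {b r} → ReachesRoot (contract t rest) b r →
                           ∃[ r′ ] ReachesRoot (Maybe.map suc t ∷ rest) (suc b) r′
  reachesRoot-uncontract t {b} (stop e) =
    fromRoot (lookup rest b) ≡.refl (≡.trans (≡.sym (lookup-contract t ≡.refl)) e)
    where
    fromRoot : ∀ x → lookup rest b ≡ x → redirect t x ≡ nothing →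
               ∃[ r′ ] ReachesRoot (Maybe.map suc t ∷ rest) (suc b) r′
    fromRoot nothing        e′ _  = _ , stop e′
    fromRoot (just zero)    e′ t≡ = _ , step e′ (stop (≡.cong (Maybe.map suc) t≡))
    fromRoot (just (suc c)) e′ ()
  reachesRoot-uncontract t {b} (step {b = c} e d) =
    fromStep (lookup rest b) ≡.refl (≡.trans (≡.sym (lookup-contract t ≡.refl)) e) (reachesRoot-uncontract t d)
    where
    fromStep : ∀ x → lookup rest b ≡ x → redirect t x ≡ just c →
               ∃[ r′ ] ReachesRoot (Maybe.map suc t ∷ rest) (suc c) r′ →
               ∃[ r′ ] ReachesRoot (Maybe.map suc t ∷ rest) (suc b) r′
    fromStep nothing         e′ ()
    fromStep (just zero)     e′ t≡    (r′ , d′) = r′ , step e′ (step (≡.cong (Maybe.map suc) t≡) d′)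
    fromStep (just (suc c′)) e′ ≡.refl (r′ , d′) = r′ , step e′ d′

  acyclicB-contract : ∀ t → acyclicB (Maybe.map suc t ∷ rest) ≡ acyclicB (contract t rest)
  acyclicB-contract t = acyclicB-≡ _ _ (mk⇔
    (λ acyc b → contract-reachesRoot t (proj₂ (acyc (suc b))))
    (λ acyc → λ { zero → root₀ t acyc ; (suc b) → reachesRoot-uncontract t (proj₂ (acyc b)) }))
    where
    root₀ : ∀ t → Acyclic (contract t rest) → ∃[ r ] ReachesRoot (Maybe.map suc t ∷ rest) zero r
    root₀ nothing  acyc = zero , stop ≡.refl
    root₀ (just k) acyc with reachesRoot-uncontract (just k) (proj₂ (acyc k))
    ... | r , d = r , step ≡.refl d

-- Adding an arc at a root
module _ {n} (f : OutSub n) (i j : Fin n) (j-root : lookup f j ≡ nothing) where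

  private
    g : OutSub n
    g = f Vec.[ j ]≔ just i

    g-j : lookup g j ≡ just i
    g-j = Vec.lookup∘update j f (just i)

    g-other : ∀ {a} → a ≢ j → lookup g a ≡ lookup f a
    g-other a≢j = Vec.lookup∘update′ a≢j f (just i)

    notRoot≢j : ∀ {a b} → lookup f a ≡ just b → a ≢ j
    notRoot≢j e ≡.refl with ≡.trans (≡.sym j-root) e
    ... | ()

  addArc-reachesRoot : ∀ {a r} → ReachesRoot g a r → ∃[ r′ ] ReachesRoot f a r′
  addArc-reachesRoot {a} (stop e) with a ≟ j
  ... | yes ≡.refl with ≡.trans (≡.sym g-j) e
  ...   | ()
  addArc-reachesRoot {a} (stop e) | no a≢j = a , stop (≡.trans (≡.sym (g-other a≢j)) e)
  addArc-reachesRoot {a} (step e d) with a ≟ j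
  ... | yes ≡.refl = j , stop j-root
  ... | no a≢j with addArc-reachesRoot d
  ...   | r′ , d′ = r′ , step (≡.trans (≡.sym (g-other a≢j)) e) d′

  -- Once i reaches j in f, every vertex reaching j in f runs round the cycle j → i → ⋯ → j in g.
  addArc-cycle : ReachesRoot f i j → ∀ {a r} → ReachesRoot g a r → ReachesRoot f a j → ⊥
  addArc-cycle i↝j {a} (stop e) a↝j with a ≟ j
  ... | yes ≡.refl with ≡.trans (≡.sym g-j) e
  ...   | ()
  addArc-cycle i↝j {a} (stop e) a↝j | no a≢j =
    a≢j (≡.sym (reachesRoot-fromRoot (≡.trans (≡.sym (g-other a≢j)) e) a↝j))
  addArc-cycle i↝j {a} (step e d) a↝j with a ≟ j
  ... | yes ≡.refl with ≡.trans (≡.sym g-j) e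
  ...   | ≡.refl = addArc-cycle i↝j d i↝j
  addArc-cycle i↝j {a} (step e d) a↝j | no a≢j =
    addArc-cycle i↝j d (reachesRoot-next (≡.trans (≡.sym (g-other a≢j)) e) a↝j)

  module _ {r} (i↝r : ReachesRoot f i r) (r≢j : r ≢ j) where

    avoidsJ : ∀ {a r′} → ReachesRoot f a r′ → r′ ≢ j → ReachesRoot g a r′
    avoidsJ (stop e)   r′≢j = stop (≡.trans (g-other r′≢j) e)
    avoidsJ (step e d) r′≢j = step (≡.trans (g-other (notRoot≢j e)) e) (avoidsJ d r′≢j)

    reachesRoot-addArc : ∀ {a r′} → ReachesRoot f a r′ → ∃[ r″ ] ReachesRoot g a r″
    reachesRoot-addArc {a} (stop e) with a ≟ j
    ... | yes ≡.refl = r , step g-j (avoidsJ i↝r r≢j)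
    ... | no a≢j     = a , stop (≡.trans (g-other a≢j) e)
    reachesRoot-addArc (step e d) with reachesRoot-addArc d
    ... | r″ , d′ = r″ , step (≡.trans (g-other (notRoot≢j e)) e) d′

  acyclicB-addArc : acyclicB (f Vec.[ j ]≔ just i) ≡ acyclicB f ∧ not (does (rootOf f i ≟ j))
  acyclicB-addArc with acyclicB f in acyc-f
  ... | false = ⇔→≡ (mk⇔ (λ acyc-g → ≡.trans (≡.sym acyc-f)
                            (Equivalence.from (acyclicB⇔Acyclic f)
                              (λ a → addArc-reachesRoot (proj₂ (Equivalence.to (acyclicB⇔Acyclic g) acyc-g a)))))
                         λ ())
  ... | true with rootOf f i ≟ j
  ...   | yes ≡.refl = ⇔→≡ (mk⇔ (λ acyc-g → ⊥-elim (addArc-cycle i↝j (acyclicB⇒reachesRoot g acyc-g i) i↝j)) λ ())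
    where
    i↝j : ReachesRoot f i (rootOf f i)
    i↝j = acyclicB⇒reachesRoot f acyc-f i
  ...   | no root≢j = Equivalence.from (acyclicB⇔Acyclic g)
                        (λ a → reachesRoot-addArc (acyclicB⇒reachesRoot f acyc-f i) root≢j
                                 (acyclicB⇒reachesRoot f acyc-f a))

if-≟-refl : ∀ {a} {A : Set a} {n} (i : Fin n) {x y : A} → (if does (i ≟ i) then x else y) ≡ x
if-≟-refl i rewrite dec-true (i ≟ i) ≡.refl = ≡.refl

if-≟-≢ : ∀ {a} {A : Set a} {n} {i j : Fin n} {x y : A} → i ≢ j → (if does (i ≟ j) then x else y) ≡ y
if-≟-≢ {i = i} {j} i≢j rewrite dec-false (i ≟ j) i≢j = ≡.refl

countB-complement : ∀ n (p : Fin n → Bool) → countB n (λ i → if p i then false else true) ℕ.+ countB n p ≡ n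
countB-complement zero    p = ≡.refl
countB-complement (suc n) p with p zero
... | true  = ≡.trans (ℕ.+-suc _ _) (≡.cong suc (countB-complement n (p ∘ suc)))
... | false = ≡.cong suc (countB-complement n (p ∘ suc))

arcCount+rootCount : ∀ {n} (f : OutSub n) → arcCount f ℕ.+ rootCount f ≡ n
arcCount+rootCount {n} f = countB-complement n (λ a → isNothing (lookup f a))

countB-remove : ∀ n (j : Fin (suc n)) (p : Fin (suc n) → Bool) →
                countB (suc n) p ≡ (if p j then 1 else 0) ℕ.+ countB n (p ∘ punchIn j)
countB-remove n       zero    p = ≡.refl
countB-remove (suc n) (suc j) p =
  ≡.trans (≡.cong ((if p zero then 1 else 0) ℕ.+_) (countB-remove n j (p ∘ suc)))
          (x∙yz≈y∙xz (if p zero then 1 else 0) (if p (suc j) then 1 else 0) _)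
  where open import Algebra.Properties.CommutativeSemigroup ℕ.+-commutativeSemigroup using (x∙yz≈y∙xz)

foldr-⊓-≤ : ∀ {A : Set} (g : A → ℕ) (n : ℕ) (xs : List A) {x : A} → x ∈ xs →
            List.foldr (λ y m → g y ℕ.⊓ m) n xs ℕ.≤ g x
foldr-⊓-≤ g n (y ∷ xs) (here ≡.refl) = ℕ.m⊓n≤m (g y) _
foldr-⊓-≤ g n (y ∷ xs) (there x∈xs)  = ℕ.≤-trans (ℕ.m⊓n≤n (g y) _) (foldr-⊓-≤ g n xs x∈xs)

allB≡false⇒∃ : ∀ n (p : Fin n → Bool) → allB n p ≡ false → ∃[ i ] p i ≡ false
allB≡false⇒∃ (suc n) p e with p zero in p₀
... | false = zero , p₀
... | true with allB≡false⇒∃ n (p ∘ suc) e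
...   | i , pᵢ = suc i , pᵢ

allMaybeFin : ∀ n → List (Maybe (Fin n))
allMaybeFin n = nothing ∷ List.map just (List.allFin n)

_≟ₘ_ : ∀ {n} → DecidableEquality (Maybe (Fin n))
_≟ₘ_ = ≡-dec _≟_

module _ {c ℓ} (R : CommutativeRing c ℓ) where
  open CommutativeRing R renaming (Carrier to C) hiding (zero)
  open import Relation.Binary.Reasoning.Setoid setoid
  open import Algebra.Properties.Ring ring using (-‿distribˡ-*; -‿distribʳ-*; -‿involutive; -‿+-comm; -0#≈0#)
  open import Algebra.Solver.Ring.NaturalCoefficients.Default commutativeSemiring using (solve; _:+_; _:*_; _:=_)
  open import Algebra.Properties.AbelianGroup +-abelianGroup using () renaming (∙-cancelʳ to +-cancelʳ)
  open import Algebra.Properties.CommutativeSemigroup *-commutativeSemigroup using () renaming (x∙yz≈y∙xz to x*yz≈y*xz)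
  open import Algebra.Properties.CommutativeSemigroup +-commutativeSemigroup using () renaming (x∙yz≈y∙xz to x+yz≈y+xz)
  import Algebra.Properties.Semiring.Sum semiring as Σ
  import Algebra.Properties.CommutativeMonoid.Sum *-commutativeMonoid as Π

  𝟙 : Bool → C
  𝟙 b = if b then 1# else 0#

  𝟙-cong : ∀ {a b} → a ≡ b → 𝟙 a ≈ 𝟙 b
  𝟙-cong ≡.refl = refl

  𝟙-∧ : ∀ a b → 𝟙 (a ∧ b) ≈ 𝟙 a * 𝟙 b
  𝟙-∧ true  b = sym (*-identityˡ _)
  𝟙-∧ false b = sym (zeroˡ _)

  𝟙-≟-refl : ∀ {n} (a : Fin n) → 𝟙 (does (a ≟ a)) ≈ 1#
  𝟙-≟-refl a = reflexive (if-≟-refl a)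

  𝟙-≟-≢ : ∀ {n} {a b : Fin n} → a ≢ b → 𝟙 (does (a ≟ b)) ≈ 0#
  𝟙-≟-≢ a≢b = reflexive (if-≟-≢ a≢b)

  sumFin≡sum : ∀ n (v : Fin n → C) → sumFin R n v ≡ Σ.sum v
  sumFin≡sum zero    v = ≡.refl
  sumFin≡sum (suc n) v = ≡.cong (v zero +_) (sumFin≡sum n (v ∘ suc))

  prodFin≡product : ∀ n (v : Fin n → C) → prodFin R n v ≡ Π.sum v
  prodFin≡product zero    v = ≡.refl
  prodFin≡product (suc n) v = ≡.cong (v zero *_) (prodFin≡product n (v ∘ suc))

  sumFin-cong : ∀ n {f g : Fin n → C} → (∀ i → f i ≈ g i) → sumFin R n f ≈ sumFin R n g
  sumFin-cong zero    f≈g = refl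
  sumFin-cong (suc n) f≈g = +-cong (f≈g zero) (sumFin-cong n (f≈g ∘ suc))

  sumFin-0 : ∀ n → sumFin R n (λ _ → 0#) ≈ 0#
  sumFin-0 n rewrite sumFin≡sum n (λ _ → 0#) = Σ.sum-replicate-zero n

  sumFin-+ : ∀ n (f g : Fin n → C) → sumFin R n (λ i → f i + g i) ≈ sumFin R n f + sumFin R n g
  sumFin-+ n f g rewrite sumFin≡sum n (λ i → f i + g i) | sumFin≡sum n f | sumFin≡sum n g =
    Σ.∑-distrib-+ f g

  *-distribˡ-sumFin : ∀ n a (f : Fin n → C) → a * sumFin R n f ≈ sumFin R n (λ i → a * f i)
  *-distribˡ-sumFin n a f rewrite sumFin≡sum n f | sumFin≡sum n (λ i → a * f i) = Σ.*-distribˡ-sum a f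

  *-distribʳ-sumFin : ∀ n a (f : Fin n → C) → sumFin R n f * a ≈ sumFin R n (λ i → f i * a)
  *-distribʳ-sumFin n a f rewrite sumFin≡sum n f | sumFin≡sum n (λ i → f i * a) = Σ.*-distribʳ-sum a f

  sumFin-comm : ∀ m n (f : Fin m → Fin n → C) →
                sumFin R m (λ i → sumFin R n (f i)) ≈ sumFin R n (λ j → sumFin R m (λ i → f i j))
  sumFin-comm zero    n f = sym (sumFin-0 n)
  sumFin-comm (suc m) n f = begin
    sumFin R n (f zero) + sumFin R m (λ i → sumFin R n (f (suc i)))       ≈⟨ +-congˡ (sumFin-comm m n (f ∘ suc)) ⟩
    sumFin R n (f zero) + sumFin R n (λ j → sumFin R m (λ i → f (suc i) j)) ≈⟨ sumFin-+ n (f zero) _ ⟨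
    sumFin R n (λ j → sumFin R (suc m) (λ i → f i j))                      ∎

  sumFin-remove : ∀ n (j : Fin (suc n)) (f : Fin (suc n) → C) →
                  sumFin R (suc n) f ≈ f j + sumFin R n (f ∘ punchIn j)
  sumFin-remove n j f rewrite sumFin≡sum (suc n) f | sumFin≡sum n (f ∘ punchIn j) = Σ.sum-remove f

  sumFin-neg : ∀ n (f : Fin n → C) → sumFin R n (λ i → - f i) ≈ - sumFin R n f
  sumFin-neg zero    f = sym -0#≈0#
  sumFin-neg (suc n) f = trans (+-congˡ (sumFin-neg n (f ∘ suc))) (-‿+-comm _ _)

  sumFin-δ : ∀ n (k : Fin n) (f : Fin n → C) → sumFin R n (λ i → 𝟙 (does (i ≟ k)) * f i) ≈ f k
  sumFin-δ (suc n) k f = begin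
    sumFin R (suc n) (λ i → 𝟙 (does (i ≟ k)) * f i)
      ≈⟨ sumFin-remove n k (λ i → 𝟙 (does (i ≟ k)) * f i) ⟩
    𝟙 (does (k ≟ k)) * f k + sumFin R n (λ l → 𝟙 (does (punchIn k l ≟ k)) * f (punchIn k l))
      ≈⟨ +-cong (trans (*-congʳ (𝟙-≟-refl k)) (*-identityˡ _))
                (trans (sumFin-cong n (λ l → trans (*-congʳ (𝟙-≟-≢ (Fin.punchInᵢ≢i k l))) (zeroˡ _))) (sumFin-0 n)) ⟩
    f k + 0#
      ≈⟨ +-identityʳ _ ⟩
    f k ∎

  prodFin-cong : ∀ n {f g : Fin n → C} → (∀ i → f i ≈ g i) → prodFin R n f ≈ prodFin R n g
  prodFin-cong zero    f≈g = refl
  prodFin-cong (suc n) f≈g = *-cong (f≈g zero) (prodFin-cong n (f≈g ∘ suc))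

  prodFin-remove : ∀ n (j : Fin (suc n)) (f : Fin (suc n) → C) →
                   prodFin R (suc n) f ≈ f j * prodFin R n (f ∘ punchIn j)
  prodFin-remove n j f rewrite prodFin≡product (suc n) f | prodFin≡product n (f ∘ punchIn j) = Π.sum-remove f

  prodFin-* : ∀ n (f g : Fin n → C) → prodFin R n (λ i → f i * g i) ≈ prodFin R n f * prodFin R n g
  prodFin-* n f g rewrite prodFin≡product n (λ i → f i * g i) | prodFin≡product n f | prodFin≡product n g =
    Π.∑-distrib-+ f g

  sumOver : ∀ {a} {A : Set a} → (A → C) → List A → C
  sumOver h xs = sumList R (List.map h xs)

  sumOver-cong∈ : ∀ {a} {A : Set a} {g h : A → C} (xs : List A) →
                  (∀ x → x ∈ xs → g x ≈ h x) → sumOver g xs ≈ sumOver h xs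
  sumOver-cong∈ []       g≈h = refl
  sumOver-cong∈ (x ∷ xs) g≈h = +-cong (g≈h x (here ≡.refl)) (sumOver-cong∈ xs (λ y y∈ → g≈h y (there y∈)))

  sumOver-cong : ∀ {a} {A : Set a} {g h : A → C} (xs : List A) → (∀ x → g x ≈ h x) → sumOver g xs ≈ sumOver h xs
  sumOver-cong xs g≈h = sumOver-cong∈ xs (λ x _ → g≈h x)

  sumOver-0 : ∀ {a} {A : Set a} (xs : List A) → sumOver (λ _ → 0#) xs ≈ 0#
  sumOver-0 []       = refl
  sumOver-0 (x ∷ xs) = trans (+-identityˡ _) (sumOver-0 xs)

  sumOver-+ : ∀ {a} {A : Set a} (g h : A → C) (xs : List A) →
              sumOver (λ x → g x + h x) xs ≈ sumOver g xs + sumOver h xs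
  sumOver-+ g h []       = sym (+-identityˡ 0#)
  sumOver-+ g h (x ∷ xs) =
    trans (+-congˡ (sumOver-+ g h xs)) (solve 4 (λ a b c d → (a :+ b) :+ (c :+ d) := (a :+ c) :+ (b :+ d)) refl _ _ _ _)

  sumOver-neg : ∀ {a} {A : Set a} (h : A → C) (xs : List A) → sumOver (λ x → - h x) xs ≈ - sumOver h xs
  sumOver-neg h []       = sym -0#≈0#
  sumOver-neg h (x ∷ xs) = trans (+-congˡ (sumOver-neg h xs)) (-‿+-comm _ _)

  *-distribˡ-sumOver : ∀ {a} {A : Set a} (c : C) (h : A → C) (xs : List A) →
                       c * sumOver h xs ≈ sumOver (λ x → c * h x) xs
  *-distribˡ-sumOver c h []       = zeroʳ c
  *-distribˡ-sumOver c h (x ∷ xs) = trans (distribˡ c _ _) (+-congˡ (*-distribˡ-sumOver c h xs))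

  *-distribʳ-sumOver : ∀ {a} {A : Set a} (c : C) (h : A → C) (xs : List A) →
                       sumOver h xs * c ≈ sumOver (λ x → h x * c) xs
  *-distribʳ-sumOver c h []       = zeroˡ c
  *-distribʳ-sumOver c h (x ∷ xs) = trans (distribʳ c _ _) (+-congˡ (*-distribʳ-sumOver c h xs))

  sumOver-filterB : ∀ {a} {A : Set a} (p : A → Bool) (h : A → C) (xs : List A) →
                    sumOver h (filterB p xs) ≈ sumOver (λ x → 𝟙 (p x) * h x) xs
  sumOver-filterB p h []       = refl
  sumOver-filterB p h (x ∷ xs) with p x
  ... | true  = +-cong (sym (*-identityˡ _)) (sumOver-filterB p h xs)
  ... | false = trans (sumOver-filterB p h xs) (trans (sym (+-identityˡ _)) (+-congʳ (sym (zeroˡ _))))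

  sumOver-++ : ∀ {a} {A : Set a} (h : A → C) (xs ys : List A) →
               sumOver h (xs List.++ ys) ≈ sumOver h xs + sumOver h ys
  sumOver-++ h []       ys = sym (+-identityˡ _)
  sumOver-++ h (x ∷ xs) ys = trans (+-congˡ (sumOver-++ h xs ys)) (sym (+-assoc _ _ _))

  sumOver-map : ∀ {a b} {A : Set a} {B : Set b} (h : B → C) (g : A → B) (xs : List A) →
                sumOver h (List.map g xs) ≡ sumOver (h ∘ g) xs
  sumOver-map h g xs = ≡.cong (sumList R) (≡.sym (List.map-∘ xs))

  sumOver-concatMap : ∀ {a b} {A : Set a} {B : Set b} (h : B → C) (F : A → List B) (xs : List A) →
                      sumOver h (List.concatMap F xs) ≈ sumOver (λ x → sumOver h (F x)) xs
  sumOver-concatMap h F []       = refl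
  sumOver-concatMap h F (x ∷ xs) = trans (sumOver-++ h (F x) _) (+-congˡ (sumOver-concatMap h F xs))

  sumOver-allVecs : ∀ {a} {A : Set a} (xs : List A) k (h : Vec A (suc k) → C) →
                    sumOver h (allVecs xs (suc k)) ≈ sumOver (λ x → sumOver (λ v → h (x ∷ v)) (allVecs xs k)) xs
  sumOver-allVecs xs k h =
    trans (sumOver-concatMap h _ xs) (sumOver-cong xs (λ x → reflexive (sumOver-map h (x ∷_) (allVecs xs k))))

  sumOver-allMaybeFin : ∀ n (h : Maybe (Fin n) → C) →
                        sumOver h (allMaybeFin n) ≈ h nothing + sumFin R n (h ∘ just)
  sumOver-allMaybeFin n h =
    +-congˡ (reflexive (≡.trans (sumOver-map h just (List.allFin n)) (sumOver-tabulate n)))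
    where
    sumOver-tabulate : ∀ m {B : Set} {g : B → C} {e : Fin m → B} → sumOver g (List.tabulate e) ≡ sumFin R m (g ∘ e)
    sumOver-tabulate zero    = ≡.refl
    sumOver-tabulate (suc m) = ≡.cong (_ +_) (sumOver-tabulate m)

  sumOver-δ : ∀ n (t : Maybe (Fin n)) (h : Maybe (Fin n) → C) →
              sumOver (λ y → 𝟙 (does (y ≟ₘ t)) * h y) (allMaybeFin n) ≈ h t
  sumOver-δ n t h = trans (sumOver-allMaybeFin n _) (δ t)
    where
    δ : ∀ t → 𝟙 (does (nothing ≟ₘ t)) * h nothing + sumFin R n (λ b → 𝟙 (does (just b ≟ₘ t)) * h (just b)) ≈ h t
    δ nothing  = trans (+-cong (*-identityˡ _) (trans (sumFin-cong n (λ _ → zeroˡ _)) (sumFin-0 n))) (+-identityʳ _)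
    δ (just k) = trans (+-cong (zeroˡ _) (sumFin-δ n k (h ∘ just))) (+-identityˡ _)

  sgn-+ : ∀ a b → sgn R (a ℕ.+ b) ≈ sgn R a * sgn R b
  sgn-+ zero    b = sym (*-identityˡ _)
  sgn-+ (suc a) b = trans (-‿cong (sgn-+ a b)) (-‿distribˡ-* _ _)

  sgn-adjacent : ∀ {a b} → Adjacent a b → sgn R a ≈ - sgn R b
  sgn-adjacent (inj₁ ≡.refl) = refl
  sgn-adjacent (inj₂ ≡.refl) = sym (-‿involutive _)

  -x*-y≈x*y : ∀ x y → - x * - y ≈ x * y
  -x*-y≈x*y x y = trans (sym (-‿distribˡ-* x (- y))) (trans (-‿cong (sym (-‿distribʳ-* x y))) (-‿involutive _))

  minor : ∀ {n} → Matrix R (suc n) → Fin (suc n) → Fin (suc n) → Matrix R n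
  minor M r c a b = M (punchIn r a) (punchIn c b)

  laplaceTerm : ∀ {n} → Matrix R (suc n) → Fin (suc n) → C
  laplaceTerm {n} M j = sgn R (toℕ j) * (M zero j * det R n (minor M zero j))

  det-cong : ∀ n {A B : Matrix R n} → (∀ a b → A a b ≈ B a b) → det R n A ≈ det R n B
  det-cong zero    A≈B = refl
  det-cong (suc n) {A} {B} A≈B =
    sumFin-cong (suc n) {laplaceTerm A} {laplaceTerm B}
      (λ j → *-congˡ (*-cong (A≈B zero j) (det-cong n (λ a b → A≈B (suc a) (punchIn j b)))))

  det-additive-column : ∀ n (k : Fin n) (A B D : Matrix R n) →
    (∀ a b → b ≢ k → A a b ≈ D a b) → (∀ a b → b ≢ k → B a b ≈ D a b) →
    (∀ a → D a k ≈ A a k + B a k) → det R n D ≈ det R n A + det R n B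
  det-additive-column (suc n) k A B D A≈D B≈D Dₖ =
    trans (sumFin-cong (suc n) term) (sumFin-+ (suc n) (laplaceTerm A) (laplaceTerm B))
    where
    term : ∀ j → laplaceTerm D j ≈ laplaceTerm A j + laplaceTerm B j
    term j with j ≟ k
    ... | yes ≡.refl = begin
      sgn R (toℕ j) * (D zero j * det R n (minor D zero j))
        ≈⟨ *-congˡ (*-congʳ (Dₖ zero)) ⟩
      sgn R (toℕ j) * ((A zero j + B zero j) * det R n (minor D zero j))
        ≈⟨ solve 4 (λ s x y d → s :* ((x :+ y) :* d) := s :* (x :* d) :+ s :* (y :* d)) refl _ _ _ _ ⟩
      sgn R (toℕ j) * (A zero j * det R n (minor D zero j)) + sgn R (toℕ j) * (B zero j * det R n (minor D zero j))
        ≈⟨ +-cong (*-congˡ (*-congˡ (det-cong n (λ a b → sym (A≈D (suc a) (punchIn j b) (Fin.punchInᵢ≢i j b))))))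
                  (*-congˡ (*-congˡ (det-cong n (λ a b → sym (B≈D (suc a) (punchIn j b) (Fin.punchInᵢ≢i j b)))))) ⟩
      laplaceTerm A j + laplaceTerm B j ∎
    ... | no j≢k = begin
      sgn R (toℕ j) * (D zero j * det R n (minor D zero j))
        ≈⟨ *-congˡ (*-congˡ minor-additive) ⟩
      sgn R (toℕ j) * (D zero j * (det R n (minor A zero j) + det R n (minor B zero j)))
        ≈⟨ solve 4 (λ s x p q → s :* (x :* (p :+ q)) := s :* (x :* p) :+ s :* (x :* q)) refl _ _ _ _ ⟩
      sgn R (toℕ j) * (D zero j * det R n (minor A zero j)) + sgn R (toℕ j) * (D zero j * det R n (minor B zero j))
        ≈⟨ +-cong (*-congˡ (*-congʳ (sym (A≈D zero j j≢k)))) (*-congˡ (*-congʳ (sym (B≈D zero j j≢k)))) ⟩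
      laplaceTerm A j + laplaceTerm B j ∎
      where
      k′ : Fin n
      k′ = punchOut j≢k
      j[k′]≡k : punchIn j k′ ≡ k
      j[k′]≡k = Fin.punchIn-punchOut j≢k
      ≢k : ∀ b → b ≢ k′ → punchIn j b ≢ k
      ≢k b b≢k′ e = b≢k′ (Fin.punchIn-injective j b k′ (≡.trans e (≡.sym j[k′]≡k)))
      minor-additive : det R n (minor D zero j) ≈ det R n (minor A zero j) + det R n (minor B zero j)
      minor-additive = det-additive-column n k′ _ _ _
        (λ a b b≢k′ → A≈D (suc a) (punchIn j b) (≢k b b≢k′))
        (λ a b b≢k′ → B≈D (suc a) (punchIn j b) (≢k b b≢k′))
        (λ a → ≡.subst (λ z → D (suc a) z ≈ A (suc a) z + B (suc a) z) (≡.sym j[k′]≡k) (Dₖ (suc a)))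

  sumFin-swapAdjacent : ∀ m (c : Fin m) (f : Fin (suc m) → C) →
                        sumFin R (suc m) (f ∘ swapAdjacent c) ≈ sumFin R (suc m) f
  sumFin-swapAdjacent (suc m) zero    f = x+yz≈y+xz _ _ _
  sumFin-swapAdjacent (suc m) (suc c) f = +-congˡ (sumFin-swapAdjacent m c (f ∘ suc))

  det-swapAdjacent-columns : ∀ m (c : Fin m) (A : Matrix R (suc m)) →
                             det R (suc m) (λ a b → A a (swapAdjacent c b)) ≈ - det R (suc m) A
  det-swapAdjacent-columns (suc m) c A = begin
    sumFin R (suc (suc m)) (laplaceTerm (λ a b → A a (swapAdjacent c b)))
      ≈⟨ sumFin-cong (suc (suc m)) term ⟩
    sumFin R (suc (suc m)) (λ l → - laplaceTerm A (swapAdjacent c l))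
      ≈⟨ sumFin-neg (suc (suc m)) (laplaceTerm A ∘ swapAdjacent c) ⟩
    - sumFin R (suc (suc m)) (laplaceTerm A ∘ swapAdjacent c)
      ≈⟨ -‿cong (sumFin-swapAdjacent (suc m) c (laplaceTerm A)) ⟩
    - sumFin R (suc (suc m)) (laplaceTerm A) ∎
    where
    term : ∀ l → laplaceTerm (λ a b → A a (swapAdjacent c b)) l ≈ - laplaceTerm A (swapAdjacent c l)
    term l with swapAdjacent-punchIn c l
    ... | inj₁ (adj , c∘l≡l′) = begin
      sgn R (toℕ l) * (A zero l′ * det R (suc m) (λ a b → A (suc a) (swapAdjacent c (punchIn l b))))
        ≈⟨ *-cong (trans (sym (-‿involutive _)) (-‿cong (sym (sgn-adjacent adj))))
                  (*-congˡ (det-cong (suc m) (λ a b → reflexive (≡.cong (A (suc a)) (c∘l≡l′ b))))) ⟩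
      - sgn R (toℕ l′) * (A zero l′ * det R (suc m) (minor A zero l′))
        ≈⟨ -‿distribˡ-* _ _ ⟨
      - laplaceTerm A l′ ∎
      where l′ = swapAdjacent c l
    ... | inj₂ (c′ , l′≡l , c∘l≡l∘c′) = begin
      sgn R (toℕ l) * (A zero (swapAdjacent c l) * det R (suc m) (λ a b → A (suc a) (swapAdjacent c (punchIn l b))))
        ≈⟨ *-congˡ (*-cong (reflexive (≡.cong (A zero) l′≡l))
             (trans (det-cong (suc m) (λ a b → reflexive (≡.cong (A (suc a)) (c∘l≡l∘c′ b))))
                    (det-swapAdjacent-columns m c′ (minor A zero l)))) ⟩
      sgn R (toℕ l) * (A zero l * - det R (suc m) (minor A zero l))
        ≈⟨ trans (*-congˡ (sym (-‿distribʳ-* _ _))) (sym (-‿distribʳ-* _ _)) ⟩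
      - laplaceTerm A l
        ≈⟨ -‿cong (reflexive (≡.cong (laplaceTerm A) l′≡l)) ⟨
      - laplaceTerm A (swapAdjacent c l) ∎

  det-zeroAt : ∀ n (k : Fin n) (B : Fin n → Fin (suc n) → C) →
               det R n (λ a b → B a (zeroAt k b)) ≈ sgn R (toℕ k) * det R n (λ a b → B a (punchIn (suc k) b))
  det-zeroAt n k = byIndex (toℕ k) n k ≡.refl
    where
    -- Column 0 of B moves to position k by k adjacent transpositions.
    byIndex : ∀ t n (k : Fin n) → toℕ k ≡ t → (B : Fin n → Fin (suc n) → C) →
              det R n (λ a b → B a (zeroAt k b)) ≈ sgn R (toℕ k) * det R n (λ a b → B a (punchIn (suc k) b))
    byIndex zero    (suc n) zero    _ B =
      trans (det-cong (suc n) (λ a b → reflexive (≡.cong (B a) (zeroAt-zero b)))) (sym (*-identityˡ _))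
    byIndex (suc t) (suc n) (suc k) k≡t B = begin
      det R (suc n) (λ a b → B a (zeroAt (suc k) b))
        ≈⟨ det-cong (suc n) (λ a b → reflexive (≡.cong (B a) (zeroAt-suc k b))) ⟩
      det R (suc n) (λ a b → B′ a (zeroAt (inject₁ k) (swapAdjacent k b)))
        ≈⟨ det-swapAdjacent-columns n k (λ a y → B′ a (zeroAt (inject₁ k) y)) ⟩
      - det R (suc n) (λ a y → B′ a (zeroAt (inject₁ k) y))
        ≈⟨ -‿cong (byIndex t (suc n) (inject₁ k) (≡.trans (Fin.toℕ-inject₁ k) (ℕ.suc-injective k≡t)) B′) ⟩
      - (sgn R (toℕ (inject₁ k)) * det R (suc n) (λ a b → B′ a (punchIn (suc (inject₁ k)) b)))
        ≈⟨ -‿cong (*-cong (reflexive (≡.cong (sgn R) (Fin.toℕ-inject₁ k)))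
                          (det-cong (suc n) (λ a b → reflexive (≡.cong (B a) (swapAdjacent-punchIn-suc k b))))) ⟩
      - (sgn R (toℕ k) * det R (suc n) (λ a b → B a (punchIn (suc (suc k)) b)))
        ≈⟨ -‿distribˡ-* _ _ ⟩
      sgn R (toℕ (suc k)) * det R (suc n) (λ a b → B a (punchIn (suc (suc k)) b)) ∎
      where
      B′ : Fin (suc n) → Fin (suc (suc n)) → C
      B′ a y = B a (swapAdjacent (suc k) y)

  contractMatrix : ∀ {n} → Maybe (Fin n) → Matrix R (suc n) → Matrix R n
  contractMatrix t M a b = M (suc a) (suc b) + 𝟙 (does (just b ≟ₘ t)) * M (suc a) zero

  outCoeff : ∀ {n} → Matrix R n → Fin n → Maybe (Fin n) → C
  outCoeff {n} M a nothing  = sumFin R n (M a)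
  outCoeff     M a (just b) = - M a b

  det-contractMatrix-nothing : ∀ n (M : Matrix R (suc n)) →
                               det R n (contractMatrix nothing M) ≈ det R n (minor M zero zero)
  det-contractMatrix-nothing n M = det-cong n (λ a b → trans (+-congˡ (zeroˡ _)) (+-identityʳ _))

  det-contractMatrix-just : ∀ n (M : Matrix R (suc n)) (k : Fin n) →
    det R n (contractMatrix (just k) M) ≈ det R n (minor M zero zero) + sgn R (toℕ k) * det R n (minor M zero (suc k))
  det-contractMatrix-just n M k =
    trans (det-additive-column n k (minor M zero zero) (λ a b → M (suc a) (zeroAt k b)) (contractMatrix (just k) M)
                               unchanged
                               (λ a b b≢k → trans (reflexive (≡.cong (M (suc a)) (zeroAt-other k b b≢k))) (unchanged a b b≢k))
                               column-k)
          (+-congˡ (det-zeroAt n k (M ∘ suc)))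
    where
    unchanged : ∀ a b → b ≢ k → M (suc a) (suc b) ≈ contractMatrix (just k) M a b
    unchanged a b b≢k = sym (trans (+-congˡ (trans (*-congʳ (𝟙-≟-≢ b≢k)) (zeroˡ _))) (+-identityʳ _))
    column-k : ∀ a → contractMatrix (just k) M a k ≈ M (suc a) (suc k) + M (suc a) (zeroAt k k)
    column-k a = +-congˡ (trans (*-congʳ (𝟙-≟-refl k))
                          (trans (*-identityˡ _) (reflexive (≡.cong (M (suc a)) (≡.sym (zeroAt-same k))))))

  x+-[x+y]≈-y : ∀ x y → x + - (x + y) ≈ - y
  x+-[x+y]≈-y x y = begin
    x + - (x + y)      ≈⟨ +-congˡ (-‿+-comm x y) ⟨
    x + (- x + - y)    ≈⟨ +-assoc _ _ _ ⟨
    (x + - x) + - y    ≈⟨ +-congʳ (-‿inverseʳ x) ⟩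
    0# + - y           ≈⟨ +-identityˡ _ ⟩
    - y                ∎

  -- By column linearity det (contractMatrix (just k) M) = D₀ ± D k; the D₀ terms
  -- recombine into the row sum of row 0, the others into the expansion along row 0.
  det-contract : ∀ n (M : Matrix R (suc n)) →
    det R (suc n) M ≈ sumOver (λ t → outCoeff M zero (Maybe.map suc t) * det R n (contractMatrix t M)) (allMaybeFin n)
  det-contract n M = sym (begin
    sumOver (λ t → outCoeff M zero (Maybe.map suc t) * det R n (contractMatrix t M)) (allMaybeFin n)
      ≈⟨ sumOver-allMaybeFin n _ ⟩
    (M zero zero + sumFin R n (M zero ∘ suc)) * det R n (contractMatrix nothing M)
      + sumFin R n (λ k → - M zero (suc k) * det R n (contractMatrix (just k) M))
      ≈⟨ +-cong (trans (*-congˡ (det-contractMatrix-nothing n M)) (distribʳ _ _ _))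
                (sumFin-cong n (λ k → *-congˡ (det-contractMatrix-just n M k))) ⟩
    (M zero zero * D₀ + sumFin R n (M zero ∘ suc) * D₀) + sumFin R n (λ k → - M zero (suc k) * (D₀ + sgn R (toℕ k) * D k))
      ≈⟨ trans (+-assoc _ _ _) (+-congˡ (trans (+-congʳ (*-distribʳ-sumFin n D₀ _)) (sym (sumFin-+ n _ _)))) ⟩
    M zero zero * D₀ + sumFin R n (λ k → M zero (suc k) * D₀ + - M zero (suc k) * (D₀ + sgn R (toℕ k) * D k))
      ≈⟨ +-cong (sym (*-identityˡ _)) (sumFin-cong n (λ k → cancel (M zero (suc k)) (sgn R (toℕ k)) (D k))) ⟩
    det R (suc n) M ∎)
    where
    D₀ : C
    D₀ = det R n (minor M zero zero)
    D : Fin n → C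
    D k = det R n (minor M zero (suc k))
    cancel : ∀ x s E → x * D₀ + - x * (D₀ + s * E) ≈ - s * (x * E)
    cancel x s E = begin
      x * D₀ + - x * (D₀ + s * E)      ≈⟨ +-congˡ (trans (sym (-‿distribˡ-* _ _)) (-‿cong (distribˡ _ _ _))) ⟩
      x * D₀ + - (x * D₀ + x * (s * E)) ≈⟨ x+-[x+y]≈-y _ _ ⟩
      - (x * (s * E))                   ≈⟨ -‿cong (x*yz≈y*xz x s E) ⟩
      - (s * (x * E))                   ≈⟨ -‿distribˡ-* _ _ ⟩
      - s * (x * E)                     ∎

  sumFin-offDiagonal-comm : ∀ n (H : Fin (suc n) → Fin (suc n) → C) →
    sumFin R (suc n) (λ j → sumFin R n (λ l → H j (punchIn j l)))
      ≈ sumFin R (suc n) (λ c → sumFin R n (λ l → H (punchIn c l) c))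
  sumFin-offDiagonal-comm n H = +-cancelʳ diagonal _ _ (begin
    sumFin R (suc n) (λ j → sumFin R n (λ l → H j (punchIn j l))) + diagonal
      ≈⟨ trans (+-comm _ _) (sym (sumFin-+ (suc n) (λ j → H j j) (λ j → sumFin R n (λ l → H j (punchIn j l))))) ⟩
    sumFin R (suc n) (λ j → H j j + sumFin R n (λ l → H j (punchIn j l)))
      ≈⟨ sumFin-cong (suc n) (λ j → sym (sumFin-remove n j (H j))) ⟩
    sumFin R (suc n) (λ j → sumFin R (suc n) (H j))
      ≈⟨ sumFin-comm (suc n) (suc n) H ⟩
    sumFin R (suc n) (λ c → sumFin R (suc n) (λ j → H j c))
      ≈⟨ sumFin-cong (suc n) (λ c → sumFin-remove n c (λ j → H j c)) ⟩
    sumFin R (suc n) (λ c → H c c + sumFin R n (λ l → H (punchIn c l) c))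
      ≈⟨ trans (sumFin-+ (suc n) (λ c → H c c) (λ c → sumFin R n (λ l → H (punchIn c l) c))) (+-comm _ _) ⟩
    sumFin R (suc n) (λ c → sumFin R n (λ l → H (punchIn c l) c)) + diagonal ∎)
    where
    diagonal : C
    diagonal = sumFin R (suc n) (λ j → H j j)

  sgn-punchIn-punchOutAt : ∀ {k} (c : Fin (suc (suc k))) (l : Fin (suc k)) →
    sgn R (toℕ (punchIn c l)) * sgn R (toℕ (punchOutAt (punchIn c l) c)) ≈ - (sgn R (toℕ c) * sgn R (toℕ l))
  sgn-punchIn-punchOutAt zero    l    = trans (*-identityʳ _) (-‿cong (sym (*-identityˡ _)))
  sgn-punchIn-punchOutAt (suc c) zero = trans (*-identityˡ _) (trans (sym (-‿involutive _)) (-‿cong (sym (*-identityʳ _))))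
  sgn-punchIn-punchOutAt {suc k} (suc c) (suc l) =
    trans (-x*-y≈x*y _ _) (trans (sgn-punchIn-punchOutAt c l) (-‿cong (sym (-x*-y≈x*y _ _))))

  sgn-punchIn-punchOutAt-+ : ∀ {k} r (c : Fin (suc (suc k))) (l : Fin (suc k)) →
    sgn R (toℕ (punchIn c l)) * sgn R (r ℕ.+ toℕ (punchOutAt (punchIn c l) c)) ≈ sgn R (suc r ℕ.+ toℕ c) * sgn R (toℕ l)
  sgn-punchIn-punchOutAt-+ r c l = begin
    P * sgn R (r ℕ.+ toℕ (punchOutAt (punchIn c l) c))   ≈⟨ *-congˡ (sgn-+ r _) ⟩
    P * (sgn R r * P′)                                     ≈⟨ x*yz≈y*xz P _ P′ ⟩
    sgn R r * (P * P′)                                     ≈⟨ *-congˡ (sgn-punchIn-punchOutAt c l) ⟩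
    sgn R r * - (sgn R (toℕ c) * sgn R (toℕ l))            ≈⟨ -‿distribʳ-* _ _ ⟨
    - (sgn R r * (sgn R (toℕ c) * sgn R (toℕ l)))          ≈⟨ -‿cong (sym (*-assoc _ _ _)) ⟩
    - (sgn R r * sgn R (toℕ c) * sgn R (toℕ l))            ≈⟨ -‿distribˡ-* _ _ ⟩
    - (sgn R r * sgn R (toℕ c)) * sgn R (toℕ l)            ≈⟨ *-congʳ (-‿cong (sym (sgn-+ r (toℕ c)))) ⟩
    sgn R (suc r ℕ.+ toℕ c) * sgn R (toℕ l)                ∎
    where
    P = sgn R (toℕ (punchIn c l))
    P′ = sgn R (toℕ (punchOutAt (punchIn c l) c))

  det-expand-row : ∀ m (r : Fin (suc m)) (A : Matrix R (suc m)) →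
    det R (suc m) A ≈ sumFin R (suc m) (λ c → sgn R (toℕ r ℕ.+ toℕ c) * (A r c * det R m (minor A r c)))
  det-expand-row m       zero    A = refl
  det-expand-row (suc m) (suc r) A = begin
    sumFin R (suc (suc m)) (laplaceTerm A)
      ≈⟨ sumFin-cong (suc (suc m)) expand-minor ⟩
    sumFin R (suc (suc m)) (λ j → sumFin R (suc m) (λ l → H j (punchIn j l)))
      ≈⟨ sumFin-offDiagonal-comm (suc m) H ⟩
    sumFin R (suc (suc m)) (λ c → sumFin R (suc m) (λ l → H (punchIn c l) c))
      ≈⟨ sumFin-cong (suc (suc m)) collect ⟩
    sumFin R (suc (suc m)) (λ c → sgn R (suc (toℕ r) ℕ.+ toℕ c) * (A (suc r) c * det R (suc m) (minor A (suc r) c))) ∎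
    where
    -- Expanding along row 0 and then row 1 + r, or the other way round, gives the terms H j c.
    H : Fin (suc (suc m)) → Fin (suc (suc m)) → C
    H j c = (sgn R (toℕ j) * sgn R (toℕ r ℕ.+ toℕ (punchOutAt j c)))
          * (A zero j * (A (suc r) c * det R m (λ a b → A (suc (punchIn r a)) (punchIn j (punchIn (punchOutAt j c) b)))))

    expand-minor : ∀ j → laplaceTerm A j ≈ sumFin R (suc m) (λ l → H j (punchIn j l))
    expand-minor j = begin
      sgn R (toℕ j) * (A zero j * det R (suc m) (minor A zero j))
        ≈⟨ *-congˡ (*-congˡ (det-expand-row m r (minor A zero j))) ⟩
      sgn R (toℕ j) * (A zero j * sumFin R (suc m) term)
        ≈⟨ trans (*-congˡ (*-distribˡ-sumFin (suc m) (A zero j) term))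
                 (*-distribˡ-sumFin (suc m) (sgn R (toℕ j)) (λ l → A zero j * term l)) ⟩
      sumFin R (suc m) (λ l → sgn R (toℕ j) * (A zero j * term l))
        ≈⟨ sumFin-cong (suc m) {λ l → sgn R (toℕ j) * (A zero j * term l)} (λ l →
             trans (solve 5 (λ s x t y e → s :* (x :* (t :* (y :* e))) := (s :* t) :* (x :* (y :* e))) refl _ _ _ _ _)
                   (reflexive (≡.sym (H-punchIn l)))) ⟩
      sumFin R (suc m) (λ l → H j (punchIn j l)) ∎
      where
      term : Fin (suc m) → C
      term l = sgn R (toℕ r ℕ.+ toℕ l) * (A (suc r) (punchIn j l) * det R m (minor (minor A zero j) r l))
      H-punchIn : ∀ l → H j (punchIn j l) ≡ (sgn R (toℕ j) * sgn R (toℕ r ℕ.+ toℕ l))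
                      * (A zero j * (A (suc r) (punchIn j l) * det R m (minor (minor A zero j) r l)))
      H-punchIn l rewrite punchOutAt-punchIn j l = ≡.refl

    collect : ∀ c → sumFin R (suc m) (λ l → H (punchIn c l) c)
                    ≈ sgn R (suc (toℕ r) ℕ.+ toℕ c) * (A (suc r) c * det R (suc m) (minor A (suc r) c))
    collect c = begin
      sumFin R (suc m) (λ l → H (punchIn c l) c)
        ≈⟨ sumFin-cong (suc m) {λ l → H (punchIn c l) c} {λ l → s * (A (suc r) c * laplaceTerm (minor A (suc r) c) l)} (λ l →
             trans (*-cong (sgn-punchIn-punchOutAt-+ (toℕ r) c l)
                           (*-congˡ (*-congˡ (det-cong m (λ a b →
                             reflexive (≡.cong (A (suc (punchIn r a))) (punchIn-punchIn-punchOutAt c l b)))))))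
                   (solve 5 (λ s t x y e → (s :* t) :* (x :* (y :* e)) := s :* (y :* (t :* (x :* e)))) refl _ _ _ _ _)) ⟩
      sumFin R (suc m) (λ l → s * (A (suc r) c * laplaceTerm (minor A (suc r) c) l))
        ≈⟨ trans (sym (*-distribˡ-sumFin (suc m) s (λ l → A (suc r) c * laplaceTerm (minor A (suc r) c) l)))
                 (*-congˡ (sym (*-distribˡ-sumFin (suc m) (A (suc r) c) (laplaceTerm (minor A (suc r) c))))) ⟩
      s * (A (suc r) c * det R (suc m) (minor A (suc r) c)) ∎
      where
      s = sgn R (suc (toℕ r) ℕ.+ toℕ c)

  -- Forest expansion of the determinant

  -- T h is the pushforward of the weight h along π.
  sumOver-allVecs-pushforward : ∀ {A B : Set} (xs : List A) (ys : List B) (π : A → B) (T : (A → C) → B → C) →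
    (∀ (Φ : B → C) (h : A → C) → sumOver (λ x → Φ (π x) * h x) xs ≈ sumOver (λ y → Φ y * T h y) ys) →
    ∀ m (G : Vec B m → C) (h : Fin m → A → C) →
    sumOver (λ v → G (Vec.map π v) * prodFin R m (λ a → h a (lookup v a))) (allVecs xs m)
      ≈ sumOver (λ u → G u * prodFin R m (λ a → T (h a) (lookup u a))) (allVecs ys m)
  sumOver-allVecs-pushforward xs ys π T push zero    G h = refl
  sumOver-allVecs-pushforward xs ys π T push (suc m) G h = begin
    sumOver (λ v → G (Vec.map π v) * prodFin R (suc m) (λ a → h a (lookup v a))) (allVecs xs (suc m))
      ≈⟨ sumOver-allVecs xs m _ ⟩
    sumOver (λ x → sumOver (λ v → G (π x ∷ Vec.map π v) * (h zero x * Πh v)) (allVecs xs m)) xs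
      ≈⟨ sumOver-cong xs (λ x → trans (sumOver-cong (allVecs xs m) (λ v → swap-last _ _ _))
                                      (sym (*-distribʳ-sumOver (h zero x) _ (allVecs xs m)))) ⟩
    sumOver (λ x → Φ (π x) * h zero x) xs
      ≈⟨ push Φ (h zero) ⟩
    sumOver (λ y → Φ y * T (h zero) y) ys
      ≈⟨ sumOver-cong ys (λ y → *-congʳ (sumOver-allVecs-pushforward xs ys π T push m (G ∘ (y ∷_)) (h ∘ suc))) ⟩
    sumOver (λ y → sumOver (λ u → G (y ∷ u) * ΠTh u) (allVecs ys m) * T (h zero) y) ys
      ≈⟨ sumOver-cong ys (λ y → trans (*-distribʳ-sumOver (T (h zero) y) _ (allVecs ys m))
                                      (sumOver-cong (allVecs ys m) (λ u → sym (swap-last _ _ _)))) ⟩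
    sumOver (λ y → sumOver (λ u → G (y ∷ u) * (T (h zero) y * ΠTh u)) (allVecs ys m)) ys
      ≈⟨ sumOver-allVecs ys m _ ⟨
    sumOver (λ u → G u * prodFin R (suc m) (λ a → T (h a) (lookup u a))) (allVecs ys (suc m)) ∎
    where
    Πh : Vec _ m → C
    Πh v = prodFin R m (λ a → h (suc a) (lookup v a))
    ΠTh : Vec _ m → C
    ΠTh u = prodFin R m (λ a → T (h (suc a)) (lookup u a))
    Φ : _ → C
    Φ y = sumOver (λ v → G (y ∷ Vec.map π v) * Πh v) (allVecs xs m)
    swap-last : ∀ g a p → g * (a * p) ≈ (g * p) * a
    swap-last = solve 3 (λ g a p → g :* (a :* p) := (g :* p) :* a) refl

  pushforward : ∀ {n} → Maybe (Fin n) → (Maybe (Fin (suc n)) → C) → Maybe (Fin n) → C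
  pushforward t h y = h (Maybe.map suc y) + 𝟙 (does (y ≟ₘ t)) * h (just zero)

  sumOver-redirect : ∀ n (t : Maybe (Fin n)) (Φ : Maybe (Fin n) → C) (h : Maybe (Fin (suc n)) → C) →
    sumOver (λ x → Φ (redirect t x) * h x) (allMaybeFin (suc n)) ≈ sumOver (λ y → Φ y * pushforward t h y) (allMaybeFin n)
  sumOver-redirect n t Φ h = begin
    sumOver (λ x → Φ (redirect t x) * h x) (allMaybeFin (suc n))
      ≈⟨ sumOver-allMaybeFin (suc n) _ ⟩
    Φ nothing * h nothing + (Φ t * h (just zero) + sumFin R n (λ b → Φ (just b) * h (just (suc b))))
      ≈⟨ solve 3 (λ a b c → a :+ (b :+ c) := (a :+ c) :+ b) refl _ _ _ ⟩
    (Φ nothing * h nothing + sumFin R n (λ b → Φ (just b) * h (just (suc b)))) + Φ t * h (just zero)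
      ≈⟨ +-cong (sym (sumOver-allMaybeFin n _)) (sym (sumOver-δ n t (λ y → Φ y * h (just zero)))) ⟩
    sumOver (λ y → Φ y * h (Maybe.map suc y)) (allMaybeFin n)
      + sumOver (λ y → 𝟙 (does (y ≟ₘ t)) * (Φ y * h (just zero))) (allMaybeFin n)
      ≈⟨ sumOver-+ _ _ (allMaybeFin n) ⟨
    sumOver (λ y → Φ y * h (Maybe.map suc y) + 𝟙 (does (y ≟ₘ t)) * (Φ y * h (just zero))) (allMaybeFin n)
      ≈⟨ sumOver-cong (allMaybeFin n) (λ y → trans (+-congˡ (x*yz≈y*xz _ _ _))
                                                    (sym (distribˡ _ _ _))) ⟩
    sumOver (λ y → Φ y * pushforward t h y) (allMaybeFin n) ∎

  pushforward-outCoeff : ∀ {n} t (M : Matrix R (suc n)) a y →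
                         pushforward t (outCoeff M (suc a)) y ≈ outCoeff (contractMatrix t M) a y
  pushforward-outCoeff {n} nothing M a nothing = begin
    (M (suc a) zero + sumFin R n (M (suc a) ∘ suc)) + 1# * - M (suc a) zero
      ≈⟨ trans (+-congˡ (*-identityˡ _)) (solve 3 (λ x s y → (x :+ s) :+ y := s :+ (x :+ y)) refl _ _ _) ⟩
    sumFin R n (M (suc a) ∘ suc) + (M (suc a) zero + - M (suc a) zero)
      ≈⟨ trans (+-congˡ (-‿inverseʳ _)) (+-identityʳ _) ⟩
    sumFin R n (M (suc a) ∘ suc)
      ≈⟨ sumFin-cong n (λ b → trans (sym (+-identityʳ _)) (+-congˡ (sym (zeroˡ _)))) ⟩
    sumFin R n (contractMatrix nothing M a) ∎
  pushforward-outCoeff {n} (just k) M a nothing = begin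
    (M (suc a) zero + sumFin R n (M (suc a) ∘ suc)) + 0# * - M (suc a) zero
      ≈⟨ trans (+-congˡ (zeroˡ _)) (trans (+-identityʳ _) (+-comm _ _)) ⟩
    sumFin R n (M (suc a) ∘ suc) + M (suc a) zero
      ≈⟨ +-congˡ (sumFin-δ n k (λ _ → M (suc a) zero)) ⟨
    sumFin R n (M (suc a) ∘ suc) + sumFin R n (λ b → 𝟙 (does (b ≟ k)) * M (suc a) zero)
      ≈⟨ sumFin-+ n _ _ ⟨
    sumFin R n (contractMatrix (just k) M a) ∎
  pushforward-outCoeff t M a (just b) = trans (+-congˡ (sym (-‿distribʳ-* _ _))) (-‿+-comm _ _)

  forestSummand : ∀ {n} → Matrix R n → OutSub n → C
  forestSummand {n} M f = 𝟙 (acyclicB f) * prodFin R n (λ a → outCoeff M a (lookup f a))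

  forestExpansion : ∀ n → Matrix R n → C
  forestExpansion n M = sumOver (forestSummand M) (allOutSubs n)

  module _ {n} (M : Matrix R (suc n)) where

    private
      V : List (Vec (Maybe (Fin (suc n))) n)
      V = allVecs (allMaybeFin (suc n)) n

      Πrest : Vec (Maybe (Fin (suc n))) n → C
      Πrest v = prodFin R n (λ a → outCoeff M (suc a) (lookup v a))

    forestExpansion-selfLoop₀ : sumOver (λ v → forestSummand M (just zero ∷ v)) V ≈ 0#
    forestExpansion-selfLoop₀ =
      trans (sumOver-cong V (λ v → trans (*-congʳ (𝟙-cong (acyclicB-selfLoop₀ v))) (zeroˡ _))) (sumOver-0 V)

    forestExpansion-contract : ∀ t → sumOver (λ v → forestSummand M (Maybe.map suc t ∷ v)) V
                                     ≈ outCoeff M zero (Maybe.map suc t) * forestExpansion n (contractMatrix t M)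
    forestExpansion-contract t = begin
      sumOver (λ v → forestSummand M (Maybe.map suc t ∷ v)) V
        ≈⟨ sumOver-cong V (λ v → trans (*-congʳ (𝟙-cong (acyclicB-contract v t))) (x*yz≈y*xz _ _ _)) ⟩
      sumOver (λ v → c₀ * (𝟙 (acyclicB (contract t v)) * Πrest v)) V
        ≈⟨ *-distribˡ-sumOver c₀ (λ v → 𝟙 (acyclicB (contract t v)) * Πrest v) V ⟨
      c₀ * sumOver (λ v → 𝟙 (acyclicB (contract t v)) * Πrest v) V
        ≈⟨ *-congˡ (sumOver-allVecs-pushforward (allMaybeFin (suc n)) (allMaybeFin n) (redirect t) (pushforward t)
                      (sumOver-redirect n t) n (𝟙 ∘ acyclicB) (outCoeff M ∘ suc)) ⟩
      c₀ * sumOver (λ u → 𝟙 (acyclicB u) * prodFin R n (λ a → pushforward t (outCoeff M (suc a)) (lookup u a))) (allOutSubs n)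
        ≈⟨ *-congˡ (sumOver-cong (allOutSubs n) (λ u →
             *-congˡ (prodFin-cong n (λ a → pushforward-outCoeff t M a (lookup u a))))) ⟩
      c₀ * forestExpansion n (contractMatrix t M) ∎
      where
      c₀ = outCoeff M zero (Maybe.map suc t)

  det≈forestExpansion : ∀ n (M : Matrix R n) → det R n M ≈ forestExpansion n M
  det≈forestExpansion zero    M = sym (trans (+-identityʳ _) (*-identityˡ _))
  det≈forestExpansion (suc n) M = begin
    det R (suc n) M
      ≈⟨ det-contract n M ⟩
    sumOver (λ t → outCoeff M zero (Maybe.map suc t) * det R n (contractMatrix t M)) (allMaybeFin n)
      ≈⟨ sumOver-cong (allMaybeFin n) (λ t → *-congˡ (det≈forestExpansion n (contractMatrix t M))) ⟩
    sumOver (λ t → outCoeff M zero (Maybe.map suc t) * forestExpansion n (contractMatrix t M)) (allMaybeFin n)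
      ≈⟨ sumOver-allMaybeFin n _ ⟩
    g nothing + sumFin R n (g ∘ just)
      ≈⟨ +-cong (sym (forestExpansion-contract M nothing))
                (trans (sym (+-identityˡ _)) (+-cong (sym (forestExpansion-selfLoop₀ M))
                                                     (sumFin-cong n (sym ∘ forestExpansion-contract M ∘ just)))) ⟩
    F nothing + (F (just zero) + sumFin R n (F ∘ just ∘ suc))
      ≈⟨ sumOver-allMaybeFin (suc n) F ⟨
    sumOver F (allMaybeFin (suc n))
      ≈⟨ sumOver-allVecs (allMaybeFin (suc n)) n _ ⟨
    forestExpansion (suc n) M ∎
    where
    g : Maybe (Fin n) → C
    g t = outCoeff M zero (Maybe.map suc t) * forestExpansion n (contractMatrix t M)
    F : Maybe (Fin (suc n)) → C
    F x = sumOver (λ v → forestSummand M (x ∷ v)) (allVecs (allMaybeFin (suc n)) n)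

  -- The adjugate
  sumOver-allVecs-update : ∀ n k (j : Fin k) (y z : Maybe (Fin n)) (H : Vec (Maybe (Fin n)) k → C) →
    sumOver (λ v → 𝟙 (does (lookup v j ≟ₘ y)) * H v) (allVecs (allMaybeFin n) k)
      ≈ sumOver (λ v → 𝟙 (does (lookup v j ≟ₘ z)) * H (v Vec.[ j ]≔ y)) (allVecs (allMaybeFin n) k)
  sumOver-allVecs-update n (suc k) zero y z H = begin
    sumOver (λ v → 𝟙 (does (lookup v zero ≟ₘ y)) * H v) (allVecs (allMaybeFin n) (suc k))
      ≈⟨ sumOver-allVecs (allMaybeFin n) k _ ⟩
    sumOver (λ x → sumOver (λ v → 𝟙 (does (x ≟ₘ y)) * H (x ∷ v)) V) (allMaybeFin n)
      ≈⟨ sumOver-cong (allMaybeFin n) (λ x → *-distribˡ-sumOver _ (λ v → H (x ∷ v)) V) ⟨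
    sumOver (λ x → 𝟙 (does (x ≟ₘ y)) * sumOver (λ v → H (x ∷ v)) V) (allMaybeFin n)
      ≈⟨ sumOver-δ n y (λ x → sumOver (λ v → H (x ∷ v)) V) ⟩
    sumOver (λ v → H (y ∷ v)) V
      ≈⟨ sumOver-δ n z (λ _ → sumOver (λ v → H (y ∷ v)) V) ⟨
    sumOver (λ x → 𝟙 (does (x ≟ₘ z)) * sumOver (λ v → H (y ∷ v)) V) (allMaybeFin n)
      ≈⟨ sumOver-cong (allMaybeFin n) (λ x → *-distribˡ-sumOver _ (λ v → H (y ∷ v)) V) ⟩
    sumOver (λ x → sumOver (λ v → 𝟙 (does (x ≟ₘ z)) * H (y ∷ v)) V) (allMaybeFin n)
      ≈⟨ sumOver-allVecs (allMaybeFin n) k _ ⟨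
    sumOver (λ v → 𝟙 (does (lookup v zero ≟ₘ z)) * H (v Vec.[ zero ]≔ y)) (allVecs (allMaybeFin n) (suc k)) ∎
    where V = allVecs (allMaybeFin n) k
  sumOver-allVecs-update n (suc k) (suc j) y z H = begin
    sumOver (λ v → 𝟙 (does (lookup v (suc j) ≟ₘ y)) * H v) (allVecs (allMaybeFin n) (suc k))
      ≈⟨ sumOver-allVecs (allMaybeFin n) k _ ⟩
    sumOver (λ x → sumOver (λ v → 𝟙 (does (lookup v j ≟ₘ y)) * H (x ∷ v)) V) (allMaybeFin n)
      ≈⟨ sumOver-cong (allMaybeFin n) (λ x → sumOver-allVecs-update n k j y z (H ∘ (x ∷_))) ⟩
    sumOver (λ x → sumOver (λ v → 𝟙 (does (lookup v j ≟ₘ z)) * H (x ∷ v Vec.[ j ]≔ y)) V) (allMaybeFin n)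
      ≈⟨ sumOver-allVecs (allMaybeFin n) k _ ⟨
    sumOver (λ v → 𝟙 (does (lookup v (suc j) ≟ₘ z)) * H (v Vec.[ suc j ]≔ y)) (allVecs (allMaybeFin n) (suc k)) ∎
    where V = allVecs (allMaybeFin n) k

  𝟙-∧-not : ∀ a r X → 𝟙 a * X + - (𝟙 (a ∧ not r) * X) ≈ 𝟙 (a ∧ r) * X
  𝟙-∧-not false r     X = trans (+-cong (zeroˡ X) (trans (-‿cong (zeroˡ X)) -0#≈0#)) (trans (+-identityˡ _) (sym (zeroˡ X)))
  𝟙-∧-not true  true  X = trans (+-congˡ (trans (-‿cong (zeroˡ X)) -0#≈0#)) (+-identityʳ _)
  𝟙-∧-not true  false X = trans (-‿inverseʳ _) (sym (zeroˡ X))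

  outCoeffsExcept : ∀ {m} → Fin (suc m) → Matrix R (suc m) → OutSub (suc m) → C
  outCoeffsExcept {m} j M f = prodFin R m (λ a → outCoeff M (punchIn j a) (lookup f (punchIn j a)))

  replaceRowByUnit : ∀ {n} → Fin n → Fin n → Matrix R n → Matrix R n
  replaceRowByUnit j i M a b = if does (a ≟ j) then 𝟙 (does (b ≟ i)) else M a b

  module _ {m} (M : Matrix R (suc m)) (i j : Fin (suc m)) where

    private
      M′ : Matrix R (suc m)
      M′ = replaceRowByUnit j i M

      M′-other : ∀ {a} b → a ≢ j → M′ a b ≡ M a b
      M′-other b a≢j = if-≟-≢ a≢j

      M′-j : ∀ b → M′ j b ≡ 𝟙 (does (b ≟ i))
      M′-j b = if-≟-refl j

    adj≈det-replaceRowByUnit : adj R (suc m) M i j ≈ det R (suc m) M′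
    adj≈det-replaceRowByUnit = sym (begin
      det R (suc m) M′
        ≈⟨ det-expand-row m j M′ ⟩
      sumFin R (suc m) (λ c → sgn R (toℕ j ℕ.+ toℕ c) * (M′ j c * det R m (minor M′ j c)))
        ≈⟨ sumFin-cong (suc m) {g = λ c → 𝟙 (does (c ≟ i)) * (sgn R (toℕ j ℕ.+ toℕ c) * det R m (minor M j c))}
             (λ c → trans (*-congˡ (*-cong (reflexive (M′-j c))
                                           (det-cong m (λ a b → reflexive (M′-other _ (Fin.punchInᵢ≢i j a))))))
                          (x*yz≈y*xz _ _ _)) ⟩
      sumFin R (suc m) (λ c → 𝟙 (does (c ≟ i)) * (sgn R (toℕ j ℕ.+ toℕ c) * det R m (minor M j c)))
        ≈⟨ sumFin-δ (suc m) i (λ c → sgn R (toℕ j ℕ.+ toℕ c) * det R m (minor M j c)) ⟩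
      sgn R (toℕ j ℕ.+ toℕ i) * det R m (minor M j i)
        ≈⟨ *-congʳ (reflexive (≡.cong (sgn R) (ℕ.+-comm (toℕ j) (toℕ i)))) ⟩
      adj R (suc m) M i j ∎)

    outCoeff-replaceRowByUnit-other : ∀ {a} y → a ≢ j → outCoeff M′ a y ≈ outCoeff M a y
    outCoeff-replaceRowByUnit-other nothing  a≢j = sumFin-cong (suc m) (λ b → reflexive (M′-other b a≢j))
    outCoeff-replaceRowByUnit-other (just b) a≢j = -‿cong (reflexive (M′-other b a≢j))

    outCoeff-replaceRowByUnit-j : ∀ y → outCoeff M′ j y ≈ 𝟙 (does (y ≟ₘ nothing)) + - 𝟙 (does (y ≟ₘ just i))
    outCoeff-replaceRowByUnit-j nothing = begin
      sumFin R (suc m) (M′ j)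
        ≈⟨ sumFin-cong (suc m) (λ c → trans (reflexive (M′-j c)) (sym (*-identityʳ _))) ⟩
      sumFin R (suc m) (λ c → 𝟙 (does (c ≟ i)) * 1#)
        ≈⟨ sumFin-δ (suc m) i (λ _ → 1#) ⟩
      1#
        ≈⟨ trans (+-congˡ -0#≈0#) (+-identityʳ _) ⟨
      1# + - 0# ∎
    outCoeff-replaceRowByUnit-j (just b) = trans (-‿cong (reflexive (M′-j b))) (sym (+-identityˡ _))

    private
      H : OutSub (suc m) → C
      H f = 𝟙 (acyclicB f) * outCoeffsExcept j M f

    forestSummand-replaceRowByUnit : ∀ f → forestSummand M′ f
      ≈ 𝟙 (does (lookup f j ≟ₘ nothing)) * H f + - (𝟙 (does (lookup f j ≟ₘ just i)) * H f)
    forestSummand-replaceRowByUnit f = begin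
      𝟙 (acyclicB f) * prodFin R (suc m) (λ a → outCoeff M′ a (lookup f a))
        ≈⟨ *-congˡ (prodFin-remove m j (λ a → outCoeff M′ a (lookup f a))) ⟩
      𝟙 (acyclicB f) * (outCoeff M′ j (lookup f j) * prodFin R m (λ a → outCoeff M′ (punchIn j a) (lookup f (punchIn j a))))
        ≈⟨ *-congˡ (*-cong (outCoeff-replaceRowByUnit-j (lookup f j))
                           (prodFin-cong m (λ a →
                              outCoeff-replaceRowByUnit-other (lookup f (punchIn j a)) (Fin.punchInᵢ≢i j a)))) ⟩
      𝟙 (acyclicB f) * ((p + - q) * outCoeffsExcept j M f)
        ≈⟨ trans (*-congˡ (distribʳ _ _ _)) (distribˡ _ _ _) ⟩
      𝟙 (acyclicB f) * (p * outCoeffsExcept j M f) + 𝟙 (acyclicB f) * (- q * outCoeffsExcept j M f)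
        ≈⟨ +-cong (x*yz≈y*xz _ _ _)
                  (trans (*-congˡ (sym (-‿distribˡ-* _ _))) (trans (sym (-‿distribʳ-* _ _)) (-‿cong (x*yz≈y*xz _ _ _)))) ⟩
      p * H f + - (q * H f) ∎
      where
      p = 𝟙 (does (lookup f j ≟ₘ nothing))
      q = 𝟙 (does (lookup f j ≟ₘ just i))

    addArc-difference : ∀ f →
      𝟙 (does (lookup f j ≟ₘ nothing)) * H f + - (𝟙 (does (lookup f j ≟ₘ nothing)) * H (f Vec.[ j ]≔ just i))
        ≈ 𝟙 (acyclicB f ∧ does (rootOf f i ≟ j)) * outCoeffsExcept j M f
    addArc-difference f with lookup f j in j-root
    ... | nothing = begin
      1# * H f + - (1# * H (f Vec.[ j ]≔ just i))
        ≈⟨ +-cong (*-identityˡ _)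
                  (-‿cong (trans (*-identityˡ _) (*-cong (𝟙-cong (acyclicB-addArc f i j j-root)) same-coeffs))) ⟩
      𝟙 (acyclicB f) * outCoeffsExcept j M f + - (𝟙 (acyclicB f ∧ not (does (rootOf f i ≟ j))) * outCoeffsExcept j M f)
        ≈⟨ 𝟙-∧-not (acyclicB f) (does (rootOf f i ≟ j)) _ ⟩
      𝟙 (acyclicB f ∧ does (rootOf f i ≟ j)) * outCoeffsExcept j M f ∎
      where
      same-coeffs : outCoeffsExcept j M (f Vec.[ j ]≔ just i) ≈ outCoeffsExcept j M f
      same-coeffs = prodFin-cong m (λ a → reflexive (≡.cong (outCoeff M (punchIn j a))
                      (Vec.lookup∘update′ (Fin.punchInᵢ≢i j a) f (just i))))
    ... | just b = trans (+-cong (zeroˡ _) (trans (-‿cong (zeroˡ _)) -0#≈0#))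
                         (trans (+-identityˡ _) (sym (trans (*-congʳ (𝟙-cong not-rooted-at-j)) (zeroˡ _))))
      where
      not-rooted-at-j : (acyclicB f ∧ does (rootOf f i ≟ j)) ≡ false
      not-rooted-at-j with acyclicB f in acyc | rootOf f i ≟ j
      ... | false | _          = ≡.refl
      ... | true  | no _       = ≡.refl
      ... | true  | yes ≡.refl with ≡.trans (≡.sym j-root) (rootOf-isRoot f i acyc)
      ...   | ()

    adj≈rootedForestExpansion : adj R (suc m) M i j ≈
      sumOver (λ f → 𝟙 (acyclicB f ∧ does (rootOf f i ≟ j)) * outCoeffsExcept j M f) (allOutSubs (suc m))
    adj≈rootedForestExpansion = begin
      adj R (suc m) M i j
        ≈⟨ trans adj≈det-replaceRowByUnit (det≈forestExpansion (suc m) M′) ⟩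
      sumOver (forestSummand M′) F
        ≈⟨ sumOver-cong F forestSummand-replaceRowByUnit ⟩
      sumOver (λ f → δ nothing f * H f + - (δ (just i) f * H f)) F
        ≈⟨ trans (sumOver-+ _ _ F) (+-congˡ (sumOver-neg _ F)) ⟩
      sumOver (λ f → δ nothing f * H f) F + - sumOver (λ f → δ (just i) f * H f) F
        ≈⟨ +-congˡ (-‿cong (sumOver-allVecs-update (suc m) (suc m) j (just i) nothing H)) ⟩
      sumOver (λ f → δ nothing f * H f) F + - sumOver (λ f → δ nothing f * H (f Vec.[ j ]≔ just i)) F
        ≈⟨ trans (+-congˡ (sym (sumOver-neg _ F))) (sym (sumOver-+ _ _ F)) ⟩
      sumOver (λ f → δ nothing f * H f + - (δ nothing f * H (f Vec.[ j ]≔ just i))) F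
        ≈⟨ sumOver-cong F addArc-difference ⟩
      sumOver (λ f → 𝟙 (acyclicB f ∧ does (rootOf f i ≟ j)) * outCoeffsExcept j M f) F ∎
      where
      F = allOutSubs (suc m)
      δ : Maybe (Fin (suc m)) → OutSub (suc m) → C
      δ y f = 𝟙 (does (lookup f j ≟ₘ y))

  sumUpTo-cong : ∀ N {f g : ℕ → C} → (∀ k → f k ≈ g k) → sumUpTo R N f ≈ sumUpTo R N g
  sumUpTo-cong zero    f≈g = f≈g zero
  sumUpTo-cong (suc N) f≈g = +-cong (sumUpTo-cong N f≈g) (f≈g (suc N))

  sumUpTo-sumOver : ∀ {a} {A : Set a} N (h : ℕ → A → C) (xs : List A) →
                    sumUpTo R N (λ k → sumOver (h k) xs) ≈ sumOver (λ x → sumUpTo R N (λ k → h k x)) xs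
  sumUpTo-sumOver zero    h xs = refl
  sumUpTo-sumOver (suc N) h xs = trans (+-congʳ (sumUpTo-sumOver N h xs)) (sym (sumOver-+ _ _ xs))

  sumUpTo-δ-beyond : ∀ N a (T : ℕ → C) → N ℕ.< a → sumUpTo R N (λ k → 𝟙 (a ℕ.≡ᵇ k) * T k) ≈ 0#
  sumUpTo-δ-beyond zero    a T N<a = trans (*-congʳ (𝟙-cong (dec-false (a ℕ.≟ 0) (ℕ.>⇒≢ N<a)))) (zeroˡ _)
  sumUpTo-δ-beyond (suc N) a T N<a =
    trans (+-cong (sumUpTo-δ-beyond N a T (ℕ.<-trans (ℕ.n<1+n N) N<a))
                  (trans (*-congʳ (𝟙-cong (dec-false (a ℕ.≟ suc N) (ℕ.>⇒≢ N<a)))) (zeroˡ _)))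
          (+-identityˡ _)

  sumUpTo-δ : ∀ N a (T : ℕ → C) → a ℕ.≤ N → sumUpTo R N (λ k → 𝟙 (a ℕ.≡ᵇ k) * T k) ≈ T a
  sumUpTo-δ zero    .zero T ℕ.z≤n = *-identityˡ _
  sumUpTo-δ (suc N) a     T a≤1+N with a ℕ.≟ suc N
  ... | yes ≡.refl = trans (+-cong (sumUpTo-δ-beyond N (suc N) T (ℕ.n<1+n N))
                                   (trans (*-congʳ (𝟙-cong (dec-true (suc N ℕ.≟ suc N) ≡.refl))) (*-identityˡ _)))
                           (+-identityˡ _)
  ... | no a≢1+N  = trans (+-cong (sumUpTo-δ N a T (ℕ.≤-pred (ℕ.≤∧≢⇒< a≤1+N a≢1+N)))
                                  (trans (*-congʳ (𝟙-cong (dec-false (a ℕ.≟ suc N) a≢1+N))) (zeroˡ _)))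
                          (+-identityʳ _)

  prodFin-if : ∀ n (p : Fin n → Bool) (x : C) → prodFin R n (λ i → if p i then x else 1#) ≈ pow R x (countB n p)
  prodFin-if zero    p x = refl
  prodFin-if (suc n) p x with p zero
  ... | true  = *-congˡ (prodFin-if n (p ∘ suc) x)
  ... | false = trans (*-identityˡ _) (prodFin-if n (p ∘ suc) x)

  prodFin-zero : ∀ n (f : Fin n → C) (i : Fin n) → f i ≈ 0# → prodFin R n f ≈ 0#
  prodFin-zero (suc n) f i fᵢ≈0 = trans (prodFin-remove n i f) (trans (*-congʳ fᵢ≈0) (zeroˡ _))

  module _ {n} (G : WDigraph R n) where

    arcCount≤n∸forestDim : ∀ f → f ∈ inForests R G → arcCount f ℕ.≤ n ∸ forestDim R G
    arcCount≤n∸forestDim f f∈ = ≡.subst (ℕ._≤ n ∸ forestDim R G) n∸rootCount≡arcCount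
      (ℕ.∸-monoʳ-≤ n (foldr-⊓-≤ rootCount n (inForests R G) f∈))
      where
      n∸rootCount≡arcCount : n ∸ rootCount f ≡ arcCount f
      n∸rootCount≡arcCount = ≡.trans (≡.cong (_∸ rootCount f) (≡.sym (arcCount+rootCount f)))
                                      (ℕ.m+n∸n≡m (arcCount f) (rootCount f))

    -- A non-arc a → b of Γ contributes the factor w a b = 0.
    𝟙-isSubB-forestWeight : ∀ f → 𝟙 (isSubB R G f) * forestWeight R G f ≈ forestWeight R G f
    𝟙-isSubB-forestWeight f with isSubB R G f in sub
    ... | true  = *-identityˡ _
    ... | false with allB≡false⇒∃ n _ sub
    ...   | a , nonArc = trans (zeroˡ _) (sym (prodFin-zero n _ a (weight0 (lookup f a) nonArc)))
      where
      weight0 : ∀ y → maybe (WDigraph.arc G a) true y ≡ false → maybe (w R G a) 1# y ≈ 0#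
      weight0 (just b) e = reflexive (≡.cong (if_then WDigraph.weight G a b else 0#) e)

    sumUpTo-Q≈sumOver-allOutSubs : ∀ (x : C) i j →
      sumUpTo R (n ∸ forestDim R G) (λ k → Q R G k i j * pow R x (n ∸ k ∸ 1))
        ≈ sumOver (λ f → 𝟙 (isSubB R G f ∧ acyclicB f)
                         * (𝟙 (does (rootOf f i ≟ j)) * (forestWeight R G f * pow R x (n ∸ arcCount f ∸ 1))))
                  (allOutSubs n)
    sumUpTo-Q≈sumOver-allOutSubs x i j = begin
      sumUpTo R N (λ k → Q R G k i j * X k)
        ≈⟨ sumUpTo-cong N (λ k → trans (*-congʳ (sumOver-filterB _ (forestWeight R G) F))
                                       (*-distribʳ-sumOver (X k) _ F)) ⟩
      sumUpTo R N (λ k → sumOver (λ f → (𝟙 ((arcCount f ℕ.≡ᵇ k) ∧ rooted f) * forestWeight R G f) * X k) F)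
        ≈⟨ sumUpTo-sumOver N _ F ⟩
      sumOver (λ f → sumUpTo R N (λ k → (𝟙 ((arcCount f ℕ.≡ᵇ k) ∧ rooted f) * forestWeight R G f) * X k)) F
        ≈⟨ sumOver-cong∈ F (λ f f∈ → trans (sumUpTo-cong N (λ k → trans (*-congʳ (*-congʳ (𝟙-∧ _ _))) (assoc4 _ _ _ _)))
                                           (sumUpTo-δ N (arcCount f) _ (arcCount≤n∸forestDim f f∈))) ⟩
      sumOver (λ f → 𝟙 (rooted f) * (forestWeight R G f * X (arcCount f))) F
        ≈⟨ sumOver-filterB _ _ (allOutSubs n) ⟩
      sumOver (λ f → 𝟙 (isSubB R G f ∧ acyclicB f) * (𝟙 (rooted f) * (forestWeight R G f * X (arcCount f)))) (allOutSubs n) ∎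
      where
      N = n ∸ forestDim R G
      X : ℕ → C
      X k = pow R x (n ∸ k ∸ 1)
      F = inForests R G
      rooted : OutSub n → Bool
      rooted f = does (rootOf f i ≟ j)
      assoc4 : ∀ a r u v → ((a * r) * u) * v ≈ a * (r * (u * v))
      assoc4 = solve 4 (λ a r u v → ((a :* r) :* u) :* v := a :* (r :* (u :* v))) refl

  laplacian-rowSum : ∀ {m} (G : WDigraph R (suc m)) a → sumFin R (suc m) (laplacian R G a) ≈ 0#
  laplacian-rowSum {m} G a = begin
    sumFin R (suc m) (laplacian R G a)
      ≈⟨ sumFin-remove m a (laplacian R G a) ⟩
    laplacian R G a a + sumFin R m (λ l → laplacian R G a (punchIn a l))
      ≈⟨ +-cong (reflexive (if-≟-refl a)) (sumFin-cong m (λ l → reflexive (if-≟-≢ (Fin.punchInᵢ≢i a l ∘ ≡.sym)))) ⟩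
    sumFin R (suc m) wₐ′ + sumFin R m (λ l → - w R G a (punchIn a l))
      ≈⟨ +-cong (sumFin-remove m a wₐ′) (sumFin-neg m (w R G a ∘ punchIn a)) ⟩
    (wₐ′ a + sumFin R m (wₐ′ ∘ punchIn a)) + - sumFin R m (w R G a ∘ punchIn a)
      ≈⟨ +-congʳ (trans (+-cong (reflexive (if-≟-refl a)) (sumFin-cong m (λ l → reflexive (if-≟-≢ (Fin.punchInᵢ≢i a l)))))
                         (+-identityˡ _)) ⟩
    sumFin R m (w R G a ∘ punchIn a) + - sumFin R m (w R G a ∘ punchIn a)
      ≈⟨ -‿inverseʳ _ ⟩
    0# ∎
    where
    wₐ′ : Fin (suc m) → C
    wₐ′ k = if does (k ≟ a) then 0# else w R G a k

  module _ {m} (G : WDigraph R (suc m)) (x : C) where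

    private
      M : Matrix R (suc m)
      M = shiftedLaplacian R G x

    shiftedLaplacian-rowSum : ∀ a → sumFin R (suc m) (M a) ≈ x
    shiftedLaplacian-rowSum a = begin
      sumFin R (suc m) (λ b → x * idMat R a b + laplacian R G a b)
        ≈⟨ sumFin-+ (suc m) (λ b → x * idMat R a b) (laplacian R G a) ⟩
      sumFin R (suc m) (λ b → x * idMat R a b) + sumFin R (suc m) (laplacian R G a)
        ≈⟨ +-cong (sumFin-remove m a (λ b → x * idMat R a b)) (laplacian-rowSum G a) ⟩
      (x * idMat R a a + sumFin R m (λ l → x * idMat R a (punchIn a l))) + 0#
        ≈⟨ +-identityʳ _ ⟩
      x * idMat R a a + sumFin R m (λ l → x * idMat R a (punchIn a l))
        ≈⟨ +-cong (*-congˡ (reflexive (if-≟-refl a)))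
                  (sumFin-cong m (λ l → *-congˡ (reflexive (if-≟-≢ (Fin.punchInᵢ≢i a l ∘ ≡.sym))))) ⟩
      x * 1# + sumFin R m (λ _ → x * 0#)
        ≈⟨ +-cong (*-identityʳ x) (trans (sumFin-cong m (λ _ → zeroʳ x)) (sumFin-0 m)) ⟩
      x + 0#
        ≈⟨ +-identityʳ x ⟩
      x ∎

    shiftedLaplacian-offDiagonal : ∀ {a b} → a ≢ b → - M a b ≈ w R G a b
    shiftedLaplacian-offDiagonal {a} {b} a≢b = begin
      - (x * idMat R a b + laplacian R G a b)
        ≈⟨ -‿cong (+-cong (*-congˡ (reflexive (if-≟-≢ a≢b))) (reflexive (if-≟-≢ a≢b))) ⟩
      - (x * 0# + - w R G a b)
        ≈⟨ -‿cong (trans (+-congʳ (zeroʳ x)) (+-identityˡ _)) ⟩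
      - - w R G a b
        ≈⟨ -‿involutive _ ⟩
      w R G a b ∎

    outCoeff-shiftedLaplacian : ∀ a y → (∀ {b} → y ≡ just b → a ≢ b) →
                                outCoeff M a y ≈ maybe (w R G a) 1# y * (if isNothing y then x else 1#)
    outCoeff-shiftedLaplacian a nothing  _      = trans (shiftedLaplacian-rowSum a) (sym (*-identityˡ x))
    outCoeff-shiftedLaplacian a (just b) noLoop = trans (shiftedLaplacian-offDiagonal (noLoop ≡.refl)) (sym (*-identityʳ _))

    outCoeffsExcept-shiftedLaplacian : ∀ {j} f → acyclicB f ≡ true → lookup f j ≡ nothing →
      outCoeffsExcept j M f ≈ forestWeight R G f * pow R x (suc m ∸ arcCount f ∸ 1)
    outCoeffsExcept-shiftedLaplacian {j} f acyc j-root = begin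
      prodFin R m (λ a → outCoeff M (punchIn j a) (y a))
        ≈⟨ prodFin-cong m (λ a → outCoeff-shiftedLaplacian (punchIn j a) (y a) (acyclicB-noSelfLoop f acyc)) ⟩
      prodFin R m (λ a → maybe (w R G (punchIn j a)) 1# (y a) * (if isNothing (y a) then x else 1#))
        ≈⟨ prodFin-* m _ _ ⟩
      prodFin R m (λ a → maybe (w R G (punchIn j a)) 1# (y a)) * prodFin R m (λ a → if isNothing (y a) then x else 1#)
        ≈⟨ *-cong weights (prodFin-if m (isNothing ∘ y) x) ⟩
      forestWeight R G f * pow R x (countB m (isNothing ∘ y))
        ≈⟨ *-congˡ (reflexive (≡.cong (pow R x) otherRoots)) ⟩
      forestWeight R G f * pow R x (suc m ∸ arcCount f ∸ 1) ∎
      where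
      y : Fin m → Maybe (Fin (suc m))
      y a = lookup f (punchIn j a)
      weights : prodFin R m (λ a → maybe (w R G (punchIn j a)) 1# (y a)) ≈ forestWeight R G f
      weights = sym (trans (prodFin-remove m j (λ a → maybe (w R G a) 1# (lookup f a)))
                           (trans (*-congʳ (reflexive (≡.cong (maybe (w R G j) 1#) j-root))) (*-identityˡ _)))
      rootCount≡ : rootCount f ≡ suc (countB m (isNothing ∘ y))
      rootCount≡ = ≡.trans (countB-remove m j (λ a → isNothing (lookup f a)))
                           (≡.cong (λ z → (if isNothing z then 1 else 0) ℕ.+ countB m (isNothing ∘ y)) j-root)
      otherRoots : countB m (isNothing ∘ y) ≡ suc m ∸ arcCount f ∸ 1
      otherRoots = ≡.sym (≡.trans (≡.cong (λ k → k ∸ arcCount f ∸ 1) (≡.sym (arcCount+rootCount f)))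
                                  (≡.cong (_∸ 1) (≡.trans (ℕ.m+n∸m≡n (arcCount f) (rootCount f)) rootCount≡)))

    rootedForestTerm-shiftedLaplacian : ∀ i j f →
      𝟙 (acyclicB f ∧ does (rootOf f i ≟ j)) * outCoeffsExcept j M f
        ≈ 𝟙 (isSubB R G f ∧ acyclicB f)
          * (𝟙 (does (rootOf f i ≟ j)) * (forestWeight R G f * pow R x (suc m ∸ arcCount f ∸ 1)))
    rootedForestTerm-shiftedLaplacian i j f with acyclicB f in acyc | rootOf f i ≟ j
    ... | false | _ = trans (zeroˡ _) (sym (trans (*-congʳ (𝟙-cong (∧-zeroʳ (isSubB R G f)))) (zeroˡ _)))
    ... | true  | no _ = trans (zeroˡ _) (sym (trans (*-congˡ (zeroˡ _)) (zeroʳ _)))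
    ... | true  | yes ≡.refl = begin
      1# * outCoeffsExcept (rootOf f i) M f
        ≈⟨ trans (*-identityˡ _) (outCoeffsExcept-shiftedLaplacian f acyc (rootOf-isRoot f i acyc)) ⟩
      forestWeight R G f * pow R x (suc m ∸ arcCount f ∸ 1)
        ≈⟨ *-congʳ (𝟙-isSubB-forestWeight G f) ⟨
      (𝟙 (isSubB R G f) * forestWeight R G f) * pow R x (suc m ∸ arcCount f ∸ 1)
        ≈⟨ trans (*-assoc _ _ _) (*-cong (𝟙-cong (≡.sym (∧-identityʳ _))) (sym (*-identityˡ _))) ⟩
      𝟙 (isSubB R G f ∧ true) * (1# * (forestWeight R G f * pow R x (suc m ∸ arcCount f ∸ 1))) ∎

-- The hypothesis 2 ≤ n only rules out n = 0.
proposition3 : ∀ {c ℓ} (R : CommutativeRing c ℓ) (n : ℕ) → 2 ≤ n →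
    (G : WDigraph R n) (x : CommutativeRing.Carrier R) (i j : Fin n) →
    CommutativeRing._≈_ R
      (adj R n (shiftedLaplacian R G x) i j)
      (sumUpTo R (n ∸ forestDim R G)
        (λ k → CommutativeRing._*_ R (Q R G k i j) (pow R x (n ∸ k ∸ 1))))
proposition3 R (suc m) _ G x i j = begin
  adj R (suc m) (shiftedLaplacian R G x) i j
    ≈⟨ adj≈rootedForestExpansion R (shiftedLaplacian R G x) i j ⟩
  sumOver R (λ f → 𝟙 R (acyclicB f ∧ does (rootOf f i ≟ j)) * outCoeffsExcept R j (shiftedLaplacian R G x) f) (allOutSubs (suc m))
    ≈⟨ sumOver-cong R (allOutSubs (suc m)) (rootedForestTerm-shiftedLaplacian R G x i j) ⟩
  sumOver R (λ f → 𝟙 R (isSubB R G f ∧ acyclicB f)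
                   * (𝟙 R (does (rootOf f i ≟ j)) * (forestWeight R G f * pow R x (suc m ∸ arcCount f ∸ 1))))
            (allOutSubs (suc m))
    ≈⟨ sumUpTo-Q≈sumOver-allOutSubs R G x i j ⟨
  sumUpTo R (suc m ∸ forestDim R G) (λ k → Q R G k i j * pow R x (suc m ∸ k ∸ 1)) ∎
  where
  open CommutativeRing R using (_*_; setoid)
  open import Relation.Binary.Reasoning.Setoid setoid
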